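{- Consider a uniformly random restricted pairing in $\mathcal{M}(L,R,{\bf d})$ and let $B_0$, $B_1$, $B_2$ be the numbers of loops, mixed double pairs and pure double pairs in it. Then ${\bf E}B_i=O(\mu_i)$ for $i=0,1,2$. If moreover $d_{\max}=o(M^{1/3})$ and $M_1(R)-M_1(L)\to\infty$, then ${\bf E}B_i\sim\mu_i$ for $i=0,1$ and ${\bf E}B_2=(1+o(1))\mu_2+o(1)$.
   Context: Setting: $L,R$ partition $[n]$, ${\bf d}=(d_1,\dots,d_n)$ nonnegative integers with $M=\sum_i d_i$ even, $d_{\max}=\max_i d_i$, $M_1(S)=\sum_{i\in S}d_i$, $M_2(S)=\sum_{i\in S}d_i(d_i-1)$, standing assumption $M_1(R)\ge M_1(L)$; asymptotics as $n\to\infty$ with $M\to\infty$. $\mu_0=\frac{(M_1(R)-M_1(L))M_2(R)}{2M_1(R)^2}$, $\mu_1=\frac{M_2(R)M_2(L)}{2M_1(R)^2}$, $\mu_2=\mu_0^2$. Pairing model: vertex $i$ is a bucket with $d_i$ points; a pairing is a perfect matching of all $M$ points; it is restricted if no pair has both points in buckets of vertices in $L$; $\mathcal{M}(L,R,{\bf d})$ is the uniformly distributed set of restricted pairings. A loop is a pair with both points in the same vertex. A double pair is a set of two pairs $\{u_1,u'_1\},\{u_2,u'_2\}$ with $u_1,u_2$ in one vertex and $u'_1,u'_2$ in another vertex; it is mixed if one of these vertices is in $L$ and the other in $R$, and pure if both are in $R$. -}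

module Defs where

open import Data.Nat as ℕ using (ℕ; zero; suc; _⊔_; _∸_; _^_)
open import Data.Nat.ListAction using (sum)
open import Data.Bool.ListAction using (and)
open import Data.Bool using (Bool; true; false; not; _∧_; _∨_; _xor_; if_then_else_)
open import Data.Fin using (Fin; _≟_)
open import Data.Product using (_×_; _,_; proj₁; proj₂; Σ; ∃)
open import Data.List using (List; []; _∷_; [_]; map; concatMap; upTo; allFin; filterᵇ; length; foldr; _++_)
open import Data.Vec using (Vec; []; _∷_; fromList)
open import Data.Integer using (+_)
open import Data.Rational using (ℚ; _/_; 0ℚ; _≤_; _<_; _+_; _*_; _-_; ∣_∣)
open import Relation.Nullary.Decidable using (⌊_⌋)
open import Relation.Binary.PropositionalEquality using (_≡_)

-- Instances: for each n, a partition (L,R) of [n] given by inL (true = in L)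
-- and a degree sequence d.

ℕtoℚ : ℕ → ℚ
ℕtoℚ k = (+ k) / 1

-- a / b in ℚ (b = 0 gives 0; never happens in the relevant range M → ∞)
ratio : ℕ → ℕ → ℚ
ratio a zero = 0ℚ
ratio a (suc b) = (+ a) / suc b

module _ {n : ℕ} (inL : Fin n → Bool) (d : Fin n → ℕ) where

  M : ℕ
  M = sum (map d (allFin n))

  dmax : ℕ
  dmax = foldr _⊔_ 0 (map d (allFin n))

  M₁L M₁R M₂L M₂R : ℕ
  M₁L = sum (map (λ i → if inL i then d i else 0) (allFin n))
  M₁R = sum (map (λ i → if inL i then 0 else d i) (allFin n))
  M₂L = sum (map (λ i → if inL i then d i ℕ.* (d i ∸ 1) else 0) (allFin n))
  M₂R = sum (map (λ i → if inL i then 0 else d i ℕ.* (d i ∸ 1)) (allFin n))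

  μ₀ μ₁ μ₂ : ℚ
  μ₀ = ratio ((M₁R ∸ M₁L) ℕ.* M₂R) (2 ℕ.* M₁R ^ 2)
  μ₁ = ratio (M₂R ℕ.* M₂L) (2 ℕ.* M₁R ^ 2)
  μ₂ = μ₀ * μ₀

-- Pairing model.  A point is (vertex, index) with index < d vertex.

Point : ℕ → Set
Point n = Fin n × ℕ

points : {n : ℕ} → (Fin n → ℕ) → List (Point n)
points {n} d = concatMap (λ i → map (i ,_) (upTo (d i))) (allFin n)

module _ {A : Set} where

  picks : ∀ {m} → Vec A (suc m) → List (A × Vec A m)
  picks {zero} (x ∷ []) = [ (x , []) ]
  picks {suc m} (x ∷ xs) = (x , xs) ∷ map (λ p → (proj₁ p , x ∷ proj₂ p)) (picks xs)

  -- all perfect matchings of the elements of a vector (each listed once)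
  matchings : ∀ m → Vec A m → List (List (A × A))
  matchings zero [] = [ [] ]
  matchings (suc zero) (x ∷ []) = []
  matchings (suc (suc m)) (x ∷ xs) =
    concatMap (λ p → map ((x , proj₁ p) ∷_) (matchings m (proj₂ p))) (picks xs)

  pairsOf : List A → List (A × A)
  pairsOf [] = []
  pairsOf (x ∷ xs) = map (x ,_) xs ++ pairsOf xs

  countᵇ : (A → Bool) → List A → ℕ
  countᵇ p xs = length (filterᵇ p xs)

Pairing : ℕ → Set
Pairing n = List (Point n × Point n)

allPairings : {n : ℕ} → (Fin n → ℕ) → List (Pairing n)
allPairings d = matchings _ (fromList (points d))

module _ {n : ℕ} (inL : Fin n → Bool) where

  _==_ : Fin n → Fin n → Bool
  i == j = ⌊ i ≟ j ⌋

  v₁ v₂ : Point n × Point n → Fin n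
  v₁ P = proj₁ (proj₁ P)
  v₂ P = proj₁ (proj₂ P)

  isRestricted : Pairing n → Bool
  isRestricted m = and (map (λ P → not (inL (v₁ P) ∧ inL (v₂ P))) m)

  isLoop : Point n × Point n → Bool
  isLoop P = v₁ P == v₂ P

  isDouble : (Point n × Point n) × (Point n × Point n) → Bool
  isDouble (P , Q) = not (v₁ P == v₂ P)
    ∧ ((v₁ P == v₁ Q ∧ v₂ P == v₂ Q) ∨ (v₁ P == v₂ Q ∧ v₂ P == v₁ Q))

  isMixed isPure : (Point n × Point n) × (Point n × Point n) → Bool
  isMixed (P , Q) = isDouble (P , Q) ∧ (inL (v₁ P) xor inL (v₂ P))
  isPure  (P , Q) = isDouble (P , Q) ∧ not (inL (v₁ P)) ∧ not (inL (v₂ P))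

  B₀ B₁ B₂ : Pairing n → ℕ
  B₀ m = countᵇ isLoop m
  B₁ m = countᵇ isMixed (pairsOf m)
  B₂ m = countᵇ isPure (pairsOf m)

  restrictedPairings : (Fin n → ℕ) → List (Pairing n)
  restrictedPairings d = filterᵇ isRestricted (allPairings d)

  𝔼 : (Fin n → ℕ) → (Pairing n → ℕ) → ℚ
  𝔼 d X = ratio (sum (map X (restrictedPairings d))) (length (restrictedPairings d))

Family : Set
Family = (n : ℕ) → (Fin n → Bool) × (Fin n → ℕ)

Eventually : (ℕ → Set) → Set
Eventually P = ∃ λ N → ∀ n → N ℕ.≤ n → P n

Tends∞ : (ℕ → ℕ) → Set
Tends∞ f = ∀ K → Eventually (λ n → K ℕ.≤ f n)

BigO : (ℕ → ℚ) → (ℕ → ℚ) → Set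
BigO f g = ∃ λ (C : ℕ) → Eventually (λ n → f n ≤ ℕtoℚ C * g n)

Asymp : (ℕ → ℚ) → (ℕ → ℚ) → Set
Asymp f g = ∀ ε → 0ℚ < ε → Eventually (λ n → ∣ f n - g n ∣ ≤ ε * g n)

AsympPlusSmall : (ℕ → ℚ) → (ℕ → ℚ) → Set
AsympPlusSmall f g = ∀ ε → 0ℚ < ε → Eventually (λ n → ∣ f n - g n ∣ ≤ ε * g n + ε)

-- a = o(b^{1/3}), i.e. a³/b → 0
LittleOCubeRoot : (ℕ → ℕ) → (ℕ → ℕ) → Set
LittleOCubeRoot a b = ∀ ε → 0ℚ < ε → Eventually (λ n → ℕtoℚ (a n ^ 3) ≤ ε * ℕtoℚ (b n))

module _ (F : Family) where
  private
    L' = λ n → proj₁ (F n)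
    d' = λ n → proj₂ (F n)

  Standing : Set
  Standing = (∀ n → ∃ λ k → M (L' n) (d' n) ≡ 2 ℕ.* k)
           × (∀ n → M₁L (L' n) (d' n) ℕ.≤ M₁R (L' n) (d' n))
           × Tends∞ (λ n → M (L' n) (d' n))

  EB₀ EB₁ EB₂ μ₀F μ₁F μ₂F : ℕ → ℚ
  EB₀ n = 𝔼 (L' n) (d' n) (B₀ (L' n))
  EB₁ n = 𝔼 (L' n) (d' n) (B₁ (L' n))
  EB₂ n = 𝔼 (L' n) (d' n) (B₂ (L' n))
  μ₀F n = μ₀ (L' n) (d' n)
  μ₁F n = μ₁ (L' n) (d' n)
  μ₂F n = μ₂ (L' n) (d' n)

  ExtraHyp : Set
  ExtraHyp = LittleOCubeRoot (λ n → dmax (L' n) (d' n)) (λ n → M (L' n) (d' n))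
           × Tends∞ (λ n → M₁R (L' n) (d' n) ∸ M₁L (L' n) (d' n))

module Submission where

open import Defs
open import Data.Product using (_×_)

-- The three means are computed exactly.  With
-- a = M₁(L), b = M₁(R) and rpm a b the number of restricted matchings of a
-- L-points and b R-points, double counting over the pairs of a matching gives
--   Σ B₀ = ℓ·rpm(a,b-2) with 2ℓ = M₂(R),   2Σ B₁ = M₂(L)M₂(R)·rpm(a-2,b-2),
--   2Σ B₂ = P·rpm(a,b-4) with 0 ≤ M₂(R)² - 2P ≤ (dmax² + dmax)M₂(R),
-- and the recurrence (b-a)·rpm(a,b) = b(b-1)·rpm(a,b-2) makes each mean an
-- explicit quotient: b/(b-1) times μ₀, μ₁, and about μ₂ for pure pairs.

module ListSums where

  open import Data.Nat using (ℕ; suc; _+_; _*_; _≤_)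
  open import Data.Nat.Properties
  open import Data.Nat.ListAction using (sum)
  open import Data.Bool using (Bool; true; false; if_then_else_; _∧_)
  open import Data.List using (List; []; _∷_; map; concatMap; _++_; filterᵇ; length)
  open import Data.List.Relation.Unary.All using (All; []; _∷_)
  open import Data.List.Relation.Unary.Any using (here; there)
  open import Data.List.Membership.Propositional using (_∈_)
  open import Relation.Binary.PropositionalEquality
  open import Algebra.Properties.CommutativeSemigroup +-commutativeSemigroup using (interchange)

  private
    variable
      B C : Set

  guard : Bool → ℕ → ℕ
  guard b n = if b then n else 0

  ind : Bool → ℕ
  ind b = guard b 1

  guard-∧ : (b c : Bool) (n : ℕ) → guard (b ∧ c) n ≡ guard b (guard c n)
  guard-∧ true c n = refl
  guard-∧ false c n = refl

  guard-comm : (b c : Bool) (n : ℕ) → guard b (guard c n) ≡ guard c (guard b n)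
  guard-comm true c n = refl
  guard-comm false true n = refl
  guard-comm false false n = refl

  guard-+ : (b : Bool) (m n : ℕ) → guard b (m + n) ≡ guard b m + guard b n
  guard-+ true m n = refl
  guard-+ false m n = refl

  guard-* : (b : Bool) (c n : ℕ) → guard b (c * n) ≡ c * guard b n
  guard-* true c n = refl
  guard-* false c n = sym (*-zeroʳ c)

  guard-ind : (b : Bool) (c : ℕ) → guard b c ≡ c * ind b
  guard-ind true c = sym (*-identityʳ c)
  guard-ind false c = sym (*-zeroʳ c)

  Σl : List B → (B → ℕ) → ℕ
  Σl [] f = 0
  Σl (x ∷ l) f = f x + Σl l f

  sum-map : (f : B → ℕ) (l : List B) → sum (map f l) ≡ Σl l f
  sum-map f [] = refl
  sum-map f (x ∷ l) = cong (f x +_) (sum-map f l)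

  length-Σ : (l : List B) → length l ≡ Σl l (λ _ → 1)
  length-Σ [] = refl
  length-Σ (x ∷ l) = cong suc (length-Σ l)

  countᵇ-Σ : (p : B → Bool) (l : List B) → countᵇ p l ≡ Σl l (λ z → ind (p z))
  countᵇ-Σ p [] = refl
  countᵇ-Σ p (x ∷ l) with p x
  ... | true = cong suc (countᵇ-Σ p l)
  ... | false = countᵇ-Σ p l

  Σl-cong : (l : List B) {f g : B → ℕ} → (∀ z → f z ≡ g z) → Σl l f ≡ Σl l g
  Σl-cong [] e = refl
  Σl-cong (x ∷ l) e = cong₂ _+_ (e x) (Σl-cong l e)

  Σl-congAll : (l : List B) {f g : B → ℕ} → All (λ z → f z ≡ g z) l → Σl l f ≡ Σl l g
  Σl-congAll [] [] = refl
  Σl-congAll (x ∷ l) (e ∷ es) = cong₂ _+_ e (Σl-congAll l es)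

  Σl-zero : (l : List B) → Σl l (λ _ → 0) ≡ 0
  Σl-zero [] = refl
  Σl-zero (x ∷ l) = Σl-zero l

  Σl-+ : (l : List B) (f g : B → ℕ) → Σl l (λ z → f z + g z) ≡ Σl l f + Σl l g
  Σl-+ [] f g = refl
  Σl-+ (x ∷ l) f g =
    trans (cong (f x + g x +_) (Σl-+ l f g)) (interchange (f x) (g x) (Σl l f) (Σl l g))

  Σl-* : (l : List B) (c : ℕ) (f : B → ℕ) → Σl l (λ z → c * f z) ≡ c * Σl l f
  Σl-* [] c f = sym (*-zeroʳ c)
  Σl-* (x ∷ l) c f = trans (cong (c * f x +_) (Σl-* l c f)) (sym (*-distribˡ-+ c (f x) (Σl l f)))

  Σl-*ʳ : (l : List B) (f : B → ℕ) (c : ℕ) → Σl l (λ z → f z * c) ≡ Σl l f * c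
  Σl-*ʳ [] f c = refl
  Σl-*ʳ (x ∷ l) f c = trans (cong (f x * c +_) (Σl-*ʳ l f c)) (sym (*-distribʳ-+ c (f x) (Σl l f)))

  Σl-++ : (l₁ l₂ : List B) (f : B → ℕ) → Σl (l₁ ++ l₂) f ≡ Σl l₁ f + Σl l₂ f
  Σl-++ [] l₂ f = refl
  Σl-++ (x ∷ l₁) l₂ f = trans (cong (f x +_) (Σl-++ l₁ l₂ f)) (sym (+-assoc (f x) _ _))

  Σl-map : (g : B → C) (l : List B) (f : C → ℕ) → Σl (map g l) f ≡ Σl l (λ z → f (g z))
  Σl-map g [] f = refl
  Σl-map g (x ∷ l) f = cong (f (g x) +_) (Σl-map g l f)

  Σl-concatMap : (h : B → List C) (l : List B) (f : C → ℕ) →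
    Σl (concatMap h l) f ≡ Σl l (λ z → Σl (h z) f)
  Σl-concatMap h [] f = refl
  Σl-concatMap h (x ∷ l) f =
    trans (Σl-++ (h x) (concatMap h l) f) (cong (Σl (h x) f +_) (Σl-concatMap h l f))

  Σl-guard : (b : Bool) (l : List B) (f : B → ℕ) → guard b (Σl l f) ≡ Σl l (λ z → guard b (f z))
  Σl-guard true l f = refl
  Σl-guard false [] f = refl
  Σl-guard false (x ∷ l) f = Σl-guard false l f

  Σl-filter : (p : B → Bool) (l : List B) (f : B → ℕ) →
    Σl (filterᵇ p l) f ≡ Σl l (λ z → guard (p z) (f z))
  Σl-filter p [] f = refl
  Σl-filter p (x ∷ l) f with p x
  ... | true = cong (f x +_) (Σl-filter p l f)
  ... | false = Σl-filter p l f

  Σl-≥ : (l : List B) (f : B → ℕ) {x : B} → x ∈ l → f x ≤ Σl l f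
  Σl-≥ (y ∷ l) f (here refl) = m≤m+n (f y) _
  Σl-≥ (y ∷ l) f (there m) = ≤-trans (Σl-≥ l f m) (m≤n+m _ (f y))

module RestrictedCount where

  open import Data.Nat using (ℕ; zero; suc; _+_; _*_; _∸_; pred; _<_; z≤n; s≤s)
  open import Data.Nat.Properties
  open import Relation.Binary.PropositionalEquality
  open import Data.Nat.Tactic.RingSolver using (solve-∀)

  -- pm b = (b-1)!! is the number of perfect matchings of b points
  -- (zero when b is odd).
  pm : ℕ → ℕ
  pm zero = 1
  pm (suc zero) = 0
  pm (suc (suc b)) = suc b * pm b

  -- rpm a b is the number of perfect matchings of a points of L and b points
  -- of R in which no pair lies inside L: each L-point takes its own R-partner.
  rpm : ℕ → ℕ → ℕ
  rpm zero b = pm b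
  rpm (suc a) zero = 0
  rpm (suc a) (suc b) = suc b * rpm a b

  rpm-one : ∀ a → rpm a 1 ≡ a * rpm a 1
  rpm-one zero = refl
  rpm-one (suc zero) = refl
  rpm-one (suc (suc a)) = sym (*-zeroʳ (suc (suc a)))

  -- Weighted recurrence behind the ratio identity below: of the b+2 R-points,
  -- b+2-a are left over for R–R pairs.
  rpm-weighted : ∀ a b →
    suc (suc b) * rpm a (suc (suc b)) ≡ a * rpm a (suc (suc b)) + suc (suc b) * suc b * rpm a b
  rpm-weighted zero b = identity (pm b) b
    where
    identity : ∀ x b → suc (suc b) * (suc b * x) ≡ 0 + suc (suc b) * suc b * x
    identity = solve-∀
  rpm-weighted (suc a) zero = step (rpm a 1) a (rpm-one a)
    where
    step : ∀ x a → x ≡ a * x → 2 * (2 * x) ≡ suc a * (2 * x) + 2 * 1 * 0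
    step x a e = begin
      2 * (2 * x)           ≡⟨ cong (λ u → 2 * (x + u)) (trans (+-identityʳ x) e) ⟩
      2 * (x + a * x)       ≡⟨ expand x a ⟩
      suc a * (2 * x) + 2 * 1 * 0 ∎
      where
      open ≡-Reasoning
      expand : ∀ x a → 2 * (x + a * x) ≡ suc a * (2 * x) + 2 * 1 * 0
      expand = solve-∀
  rpm-weighted (suc a) (suc b) = step (rpm a (suc (suc b))) (rpm a b) (rpm-weighted a b)
    where
    step : ∀ X Y → suc (suc b) * X ≡ a * X + suc (suc b) * suc b * Y →
      suc (suc (suc b)) * (suc (suc (suc b)) * X) ≡
      suc a * (suc (suc (suc b)) * X) + suc (suc (suc b)) * suc (suc b) * (suc b * Y)
    step X Y h = begin
      (3 + b) * ((3 + b) * X)                       ≡⟨ split X b ⟩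
      (3 + b) * X + (3 + b) * ((2 + b) * X)         ≡⟨ cong (λ u → (3 + b) * X + (3 + b) * u) h ⟩
      (3 + b) * X + (3 + b) * (a * X + (2 + b) * (1 + b) * Y) ≡⟨ regroup X Y a b ⟩
      suc a * ((3 + b) * X) + (3 + b) * (2 + b) * ((1 + b) * Y) ∎
      where
      open ≡-Reasoning
      split : ∀ X b → (3 + b) * ((3 + b) * X) ≡ (3 + b) * X + (3 + b) * ((2 + b) * X)
      split = solve-∀
      regroup : ∀ X Y a b → (3 + b) * X + (3 + b) * (a * X + (2 + b) * (1 + b) * Y) ≡
        suc a * ((3 + b) * X) + (3 + b) * (2 + b) * ((1 + b) * Y)
      regroup = solve-∀

  -- The ratio identity  (b+2-a) · rpm a (b+2) = (b+2)(b+1) · rpm a b,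
  -- which turns every expectation below into an explicit rational function.
  rpm-ratio : ∀ a b → (suc (suc b) ∸ a) * rpm a (suc (suc b)) ≡ suc (suc b) * suc b * rpm a b
  rpm-ratio a b = trans (*-distribʳ-∸ (rpm a (suc (suc b))) (suc (suc b)) a)
    (trans (cong (_∸ a * rpm a (suc (suc b))) (rpm-weighted a b))
           (m+n∸m≡n (a * rpm a (suc (suc b))) _))

  -- Recurrence by the partner of one distinguished R-point: an L-point
  -- (a choices) or another R-point (b choices).
  rpm-firstR : ∀ a b → rpm a (suc b) ≡ a * rpm (pred a) b + b * rpm a (pred b)
  rpm-firstR zero zero = refl
  rpm-firstR zero (suc c) = refl
  rpm-firstR (suc zero) zero = refl
  rpm-firstR (suc (suc a)) zero = sym (trans (+-identityʳ _) (*-zeroʳ (suc (suc a))))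
  rpm-firstR (suc a) (suc zero) = step (rpm a 1) a (rpm-one a)
    where
    step : ∀ x a → x ≡ a * x → 2 * x ≡ suc a * x + 1 * 0
    step x a e = trans (double x) (trans (cong (x +_) e) (regroup x a))
      where
      double : ∀ x → 2 * x ≡ x + x
      double = solve-∀
      regroup : ∀ x a → x + a * x ≡ suc a * x + 1 * 0
      regroup = solve-∀
  rpm-firstR (suc a) (suc (suc b)) = step (rpm a (suc (suc b))) (rpm a b) (rpm-weighted a b)
    where
    step : ∀ X Y → suc (suc b) * X ≡ a * X + suc (suc b) * suc b * Y →
      suc (suc (suc b)) * X ≡ suc a * X + suc (suc b) * (suc b * Y)
    step X Y h = trans (cong (X +_) h) (regroup X Y a b)
      where
      regroup : ∀ X Y a b → X + (a * X + suc (suc b) * suc b * Y) ≡ suc a * X + suc (suc b) * (suc b * Y)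
      regroup = solve-∀

  private
    positive-* : ∀ m {n} → 0 < n → 0 < suc m * n
    positive-* m {suc n} _ = s≤s z≤n

  rpm-pos : ∀ a k → 0 < rpm a (a + 2 * k)
  rpm-pos zero k = pm-pos k
    where
    pm-pos : ∀ k → 0 < pm (2 * k)
    pm-pos zero = s≤s z≤n
    pm-pos (suc k) rewrite +-suc k (k + 0) = positive-* (k + (k + 0)) (pm-pos k)
  rpm-pos (suc a) k = positive-* (a + 2 * k) (rpm-pos a k)

module Selections where

  open import Data.Nat using (ℕ; zero; suc; _+_; _*_; pred; _≤_; z≤n)
  open import Data.Nat.Properties
  open import Data.Product using (_×_; _,_; proj₁; proj₂)
  open import Data.List using (List; []; _∷_; map; _++_)
  open import Data.Vec using (Vec; []; _∷_)
  open import Data.List.Relation.Unary.All as All using (All; []; _∷_)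
  import Data.List.Relation.Unary.All.Properties as AllP
  open import Relation.Binary.PropositionalEquality
  open import Data.Nat.Tactic.RingSolver using (solve-∀)
  open import Algebra.Properties.CommutativeSemigroup +-commutativeSemigroup
    using (interchange) renaming (x∙yz≈y∙xz to +-exchange)
  open ListSums

  module _ {A : Set} where

    picksL : List A → List (A × List A)
    picksL [] = []
    picksL (x ∷ l) = (x , l) ∷ map (λ p → (proj₁ p , x ∷ proj₂ p)) (picksL l)

    picksL-Σ : (m : List A) (w : A → ℕ) → Σl (picksL m) (λ p → w (proj₁ p)) ≡ Σl m w
    picksL-Σ [] w = refl
    picksL-Σ (x ∷ m) w = cong (w x +_) (trans (Σl-map _ (picksL m) _) (picksL-Σ m w))

    picksL-pairs : (m : List A) (f : A → A → ℕ) →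
      Σl (picksL m) (λ p → Σl (proj₂ p) (f (proj₁ p))) ≡
      Σl (pairsOf m) (λ PQ → f (proj₁ PQ) (proj₂ PQ)) + Σl (pairsOf m) (λ PQ → f (proj₂ PQ) (proj₁ PQ))
    picksL-pairs [] f = refl
    picksL-pairs (x ∷ m) f = begin
      Σl m (f x) + Σl (map shift (picksL m)) inner
        ≡⟨ cong (Σl m (f x) +_) (trans (Σl-map shift (picksL m) inner)
                                  (Σl-+ (picksL m) (λ p → f (proj₁ p) x) inner)) ⟩
      Σl m (f x) + (Σl (picksL m) (λ p → f (proj₁ p) x) + Σl (picksL m) inner)
        ≡⟨ cong (λ u → Σl m (f x) + (u + Σl (picksL m) inner)) (picksL-Σ m (λ y → f y x)) ⟩
      Σl m (f x) + (Σl m (λ y → f y x) + Σl (picksL m) inner)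
        ≡⟨ cong (λ u → Σl m (f x) + (Σl m (λ y → f y x) + u)) (picksL-pairs m f) ⟩
      Σl m (f x) + (Σl m (λ y → f y x) + (P m f + P m (λ a b → f b a)))
        ≡⟨ regroup (Σl m (f x)) (Σl m (λ y → f y x)) (P m f) (P m (λ a b → f b a)) ⟩
      (Σl m (f x) + P m f) + (Σl m (λ y → f y x) + P m (λ a b → f b a))
        ≡⟨ sym (cong₂ _+_ (headPairs f) (headPairs (λ a b → f b a))) ⟩
      P (x ∷ m) f + P (x ∷ m) (λ a b → f b a) ∎
      where
      open ≡-Reasoning
      P : List A → (A → A → ℕ) → ℕ
      P l g = Σl (pairsOf l) (λ PQ → g (proj₁ PQ) (proj₂ PQ))
      shift : A × List A → A × List A
      shift p = (proj₁ p , x ∷ proj₂ p)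
      inner : A × List A → ℕ
      inner p = Σl (proj₂ p) (f (proj₁ p))
      regroup : ∀ a b c d → a + (b + (c + d)) ≡ a + c + (b + d)
      regroup = solve-∀
      headPairs : (g : A → A → ℕ) → P (x ∷ m) g ≡ Σl m (g x) + P m g
      headPairs g = trans (Σl-++ (map (x ,_) m) (pairsOf m) _) (cong (_+ P m g) (Σl-map (x ,_) m _))

    Σv : ∀ {k} → Vec A k → (A → ℕ) → ℕ
    Σv [] h = 0
    Σv (x ∷ xs) h = h x + Σv xs h

    ΣP : ∀ {k} → Vec A k → (A → A → ℕ) → ℕ
    ΣP [] f = 0
    ΣP (x ∷ xs) f = Σv xs (f x) + ΣP xs f

    Σv-cong : ∀ {k} (xs : Vec A k) {f h : A → ℕ} → (∀ z → f z ≡ h z) → Σv xs f ≡ Σv xs h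
    Σv-cong [] e = refl
    Σv-cong (x ∷ xs) e = cong₂ _+_ (e x) (Σv-cong xs e)

    Σv-zero : ∀ {k} (xs : Vec A k) → Σv xs (λ _ → 0) ≡ 0
    Σv-zero [] = refl
    Σv-zero (_ ∷ xs) = Σv-zero xs

    Σv-+ : ∀ {k} (xs : Vec A k) (f h : A → ℕ) → Σv xs (λ z → f z + h z) ≡ Σv xs f + Σv xs h
    Σv-+ [] f h = refl
    Σv-+ (x ∷ xs) f h = trans (cong (f x + h x +_) (Σv-+ xs f h)) (interchange (f x) (h x) (Σv xs f) (Σv xs h))

    Σv-* : ∀ {k} (xs : Vec A k) (c : ℕ) (f : A → ℕ) → Σv xs (λ z → c * f z) ≡ c * Σv xs f
    Σv-* [] c f = sym (*-zeroʳ c)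
    Σv-* (x ∷ xs) c f = trans (cong (c * f x +_) (Σv-* xs c f)) (sym (*-distribˡ-+ c (f x) (Σv xs f)))

    Σv-mono : ∀ {k} (xs : Vec A k) {f h : A → ℕ} → (∀ u → f u ≤ h u) → Σv xs f ≤ Σv xs h
    Σv-mono [] le = z≤n
    Σv-mono (x ∷ xs) le = +-mono-≤ (le x) (Σv-mono xs le)

    ΣP-cong : ∀ {k} (xs : Vec A k) {f h : A → A → ℕ} → (∀ u v → f u v ≡ h u v) → ΣP xs f ≡ ΣP xs h
    ΣP-cong [] e = refl
    ΣP-cong (x ∷ xs) e = cong₂ _+_ (Σv-cong xs (e x)) (ΣP-cong xs e)

    ΣP-zero : ∀ {k} (xs : Vec A k) → ΣP xs (λ _ _ → 0) ≡ 0
    ΣP-zero [] = refl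
    ΣP-zero (x ∷ xs) = trans (cong (_+ ΣP xs (λ _ _ → 0)) (Σv-zero xs)) (ΣP-zero xs)

    ΣP-+ : ∀ {k} (xs : Vec A k) (f h : A → A → ℕ) → ΣP xs (λ u v → f u v + h u v) ≡ ΣP xs f + ΣP xs h
    ΣP-+ [] f h = refl
    ΣP-+ (x ∷ xs) f h =
      trans (cong₂ _+_ (Σv-+ xs (f x) (h x)) (ΣP-+ xs f h)) (interchange (Σv xs (f x)) (Σv xs (h x)) (ΣP xs f) (ΣP xs h))

    ΣP-* : ∀ {k} (xs : Vec A k) (c : ℕ) (f : A → A → ℕ) → ΣP xs (λ u v → c * f u v) ≡ c * ΣP xs f
    ΣP-* [] c f = sym (*-zeroʳ c)
    ΣP-* (x ∷ xs) c f = trans (cong₂ _+_ (Σv-* xs c (f x)) (ΣP-* xs c f)) (sym (*-distribˡ-+ c _ _))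

    ΣP-mono : ∀ {k} (xs : Vec A k) {f h : A → A → ℕ} → (∀ u v → f u v ≤ h u v) → ΣP xs f ≤ ΣP xs h
    ΣP-mono [] le = z≤n
    ΣP-mono (x ∷ xs) le = +-mono-≤ (Σv-mono xs (le x)) (ΣP-mono xs le)

    ΣP-product : ∀ {k} (xs : Vec A k) (h₁ h₂ : A → ℕ) →
      ΣP xs (λ u v → h₁ u * h₂ v + h₂ u * h₁ v) + Σv xs (λ u → h₁ u * h₂ u) ≡ Σv xs h₁ * Σv xs h₂
    ΣP-product [] h₁ h₂ = refl
    ΣP-product (x ∷ xs) h₁ h₂ = begin
      Σv xs (λ v → h₁ x * h₂ v + h₂ x * h₁ v) + P + (h₁ x * h₂ x + S)
        ≡⟨ cong (λ u → u + P + (h₁ x * h₂ x + S))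
                (trans (Σv-+ xs (λ v → h₁ x * h₂ v) (λ v → h₂ x * h₁ v))
                       (cong₂ _+_ (Σv-* xs (h₁ x) h₂) (Σv-* xs (h₂ x) h₁))) ⟩
      h₁ x * Σv xs h₂ + h₂ x * Σv xs h₁ + P + (h₁ x * h₂ x + S)
        ≡⟨ regroup (h₁ x) (h₂ x) (Σv xs h₁) (Σv xs h₂) P S ⟩
      h₁ x * h₂ x + h₁ x * Σv xs h₂ + h₂ x * Σv xs h₁ + (P + S)
        ≡⟨ cong (h₁ x * h₂ x + h₁ x * Σv xs h₂ + h₂ x * Σv xs h₁ +_) (ΣP-product xs h₁ h₂) ⟩
      h₁ x * h₂ x + h₁ x * Σv xs h₂ + h₂ x * Σv xs h₁ + Σv xs h₁ * Σv xs h₂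
        ≡⟨ factor (h₁ x) (h₂ x) (Σv xs h₁) (Σv xs h₂) ⟩
      (h₁ x + Σv xs h₁) * (h₂ x + Σv xs h₂) ∎
      where
      open ≡-Reasoning
      P : ℕ
      P = ΣP xs (λ u v → h₁ u * h₂ v + h₂ u * h₁ v)
      S : ℕ
      S = Σv xs (λ u → h₁ u * h₂ u)
      regroup : ∀ a b A B P S → a * B + b * A + P + (a * b + S) ≡ a * b + a * B + b * A + (P + S)
      regroup = solve-∀
      factor : ∀ a b A B → a * b + a * B + b * A + A * B ≡ (a + A) * (b + B)
      factor = solve-∀

    pick₁ : ∀ {k} → Vec A k → List (A × Vec A (pred k))
    pick₁ [] = []
    pick₁ (x ∷ xs) = picks (x ∷ xs)

    pick₂ : ∀ {k} → Vec A k → List (A × A × Vec A (pred (pred k)))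
    pick₂ [] = []
    pick₂ (x ∷ []) = []
    pick₂ (x ∷ y ∷ []) = (x , y , []) ∷ []
    pick₂ (x ∷ y ∷ z ∷ xs) = map (λ p → (x , proj₁ p , proj₂ p)) (picks (y ∷ z ∷ xs))
                         ++ map (λ t → (proj₁ t , proj₁ (proj₂ t) , x ∷ proj₂ (proj₂ t))) (pick₂ (y ∷ z ∷ xs))

    Σpick₁ : ∀ k (r : Vec A k) (h : A → ℕ) → Σl (pick₁ r) (λ p → h (proj₁ p)) ≡ Σv r h
    Σpick₁ zero [] h = refl
    Σpick₁ (suc zero) (x ∷ []) h = refl
    Σpick₁ (suc (suc k)) (x ∷ w ∷ ws) h =
      cong (h x +_) (trans (Σl-map _ (picks (w ∷ ws)) _) (Σpick₁ (suc k) (w ∷ ws) h))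

    -- Splitting off the first entry: either it is removed, or it stays in
    -- the remainder.
    Σpick₁-cons : ∀ {k} (x : A) (r : Vec A (suc k)) (H : A → Vec A (suc k) → ℕ) →
      Σl (pick₁ (x ∷ r)) (λ p → H (proj₁ p) (proj₂ p)) ≡
      H x r + Σl (pick₁ r) (λ p → H (proj₁ p) (x ∷ proj₂ p))
    Σpick₁-cons x (w ∷ ws) H = cong (H x (w ∷ ws) +_) (Σl-map _ (picks (w ∷ ws)) _)

    Σpick₂-cons : ∀ {k} (x : A) (r : Vec A (suc (suc k))) (H : A → A → Vec A (suc k) → ℕ) →
      Σl (pick₂ (x ∷ r)) (λ t → H (proj₁ t) (proj₁ (proj₂ t)) (proj₂ (proj₂ t))) ≡
      Σl (pick₁ r) (λ p → H x (proj₁ p) (proj₂ p)) +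
      Σl (pick₂ r) (λ t → H (proj₁ t) (proj₁ (proj₂ t)) (x ∷ proj₂ (proj₂ t)))
    Σpick₂-cons x (y ∷ z ∷ zs) H =
      trans (Σl-++ (map _ (pick₁ (y ∷ z ∷ zs))) (map _ (pick₂ (y ∷ z ∷ zs))) _)
            (cong₂ _+_ (Σl-map _ (pick₁ (y ∷ z ∷ zs)) _) (Σl-map _ (pick₂ (y ∷ z ∷ zs)) _))

    Σpick₂ : ∀ k (xs : Vec A k) (f : A → A → ℕ) → Σl (pick₂ xs) (λ t → f (proj₁ t) (proj₁ (proj₂ t))) ≡ ΣP xs f
    Σpick₂ zero [] f = refl
    Σpick₂ (suc zero) (x ∷ []) f = refl
    Σpick₂ (suc (suc zero)) (x ∷ y ∷ []) f = sym (+-identityʳ (f x y + 0))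
    Σpick₂ (suc (suc (suc k))) (x ∷ r) f =
      trans (Σpick₂-cons x r (λ a b _ → f a b)) (cong₂ _+_ (Σpick₁ (suc (suc k)) r (f x)) (Σpick₂ (suc (suc k)) r f))

    pickTwice : ∀ {j} → Vec A (suc (suc j)) → (A → A → Vec A j → ℕ) → ℕ
    pickTwice v H = Σl (pick₁ v) (λ p → Σl (pick₁ (proj₂ p)) (λ q → H (proj₁ p) (proj₁ q) (proj₂ q)))

    -- The first entry is removed first, removed second, or kept.
    pickTwice-cons : ∀ {j} (x : A) (r : Vec A (suc (suc j))) (H : A → A → Vec A (suc j) → ℕ) →
      pickTwice (x ∷ r) H ≡
      Σl (pick₁ r) (λ q → H x (proj₁ q) (proj₂ q)) +
      (Σl (pick₁ r) (λ p → H (proj₁ p) x (proj₂ p)) + pickTwice r (λ a b v → H a b (x ∷ v)))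
    pickTwice-cons x r H =
      trans (Σpick₁-cons x r (λ a v → Σl (pick₁ v) (λ q → H a (proj₁ q) (proj₂ q))))
        (cong (Σl (pick₁ r) (λ q → H x (proj₁ q) (proj₂ q)) +_)
          (trans (Σl-cong (pick₁ r) (λ p → Σpick₁-cons x (proj₂ p) (H (proj₁ p))))
                 (Σl-+ (pick₁ r) _ _)))

    pickTwice-swap : ∀ {j} (xs : Vec A (suc (suc j))) (F : A → A → Vec A j → ℕ) →
      pickTwice xs F ≡ pickTwice xs (λ a b v → F b a v)
    pickTwice-swap (x ∷ y ∷ []) F = base (F x y []) (F y x [])
      where
      base : ∀ a b → a + 0 + (b + 0 + 0) ≡ b + 0 + (a + 0 + 0)
      base = solve-∀
    pickTwice-swap (x ∷ r@(y ∷ z ∷ zs)) F = begin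
      pickTwice (x ∷ r) F
        ≡⟨ pickTwice-cons x r F ⟩
      first + (second + pickTwice r (λ a b v → F a b (x ∷ v)))
        ≡⟨ cong (λ u → first + (second + u)) (pickTwice-swap r (λ a b v → F a b (x ∷ v))) ⟩
      first + (second + pickTwice r (λ a b v → F b a (x ∷ v)))
        ≡⟨ +-exchange first second _ ⟩
      second + (first + pickTwice r (λ a b v → F b a (x ∷ v)))
        ≡⟨ sym (pickTwice-cons x r (λ a b v → F b a v)) ⟩
      pickTwice (x ∷ r) (λ a b v → F b a v) ∎
      where
      open ≡-Reasoning
      first : ℕ
      first = Σl (pick₁ r) (λ q → F x (proj₁ q) (proj₂ q))
      second : ℕ
      second = Σl (pick₁ r) (λ p → F (proj₁ p) x (proj₂ p))

    pickThenPair pairThenPick : ∀ {k} → Vec A k → (A → A → A → Vec A (pred (pred (pred k))) → ℕ) → ℕ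
    pickThenPair xs H =
      Σl (pick₁ xs) (λ p → Σl (pick₂ (proj₂ p)) (λ t → H (proj₁ p) (proj₁ t) (proj₁ (proj₂ t)) (proj₂ (proj₂ t))))
    pairThenPick xs H =
      Σl (pick₂ xs) (λ t → Σl (pick₁ (proj₂ (proj₂ t))) (λ q → H (proj₁ q) (proj₁ t) (proj₁ (proj₂ t)) (proj₂ q)))

    pick-pair-exchange : ∀ k (xs : Vec A k) (H : A → A → A → Vec A (pred (pred (pred k))) → ℕ) →
      pickThenPair xs H ≡ pairThenPick xs H
    pick-pair-exchange zero [] H = refl
    pick-pair-exchange (suc zero) (x ∷ []) H = refl
    pick-pair-exchange (suc (suc zero)) (x ∷ y ∷ []) H = refl
    pick-pair-exchange (suc (suc (suc zero))) (x ∷ y ∷ z ∷ []) H = base (H x y z []) (H y x z []) (H z x y [])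
      where
      base : ∀ a b c → a + 0 + (b + 0 + (c + 0 + 0)) ≡ c + 0 + (b + 0 + (a + 0 + 0))
      base = solve-∀
    pick-pair-exchange (suc (suc (suc (suc k)))) (x ∷ r@(y ∷ z ∷ zs)) H = begin
      pickThenPair (x ∷ r) H
        ≡⟨ Σpick₁-cons x r (λ a v → Σl (pick₂ v) (λ t → H a (proj₁ t) (proj₁ (proj₂ t)) (proj₂ (proj₂ t)))) ⟩
      pairs + Σl (pick₁ r) (λ p → Σl (pick₂ (x ∷ proj₂ p)) (λ t → H (proj₁ p) (proj₁ t) (proj₁ (proj₂ t)) (proj₂ (proj₂ t))))
        ≡⟨ cong (pairs +_) (trans (Σl-cong (pick₁ r) (λ p → Σpick₂-cons x (proj₂ p) (H (proj₁ p))))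
                                (Σl-+ (pick₁ r) (λ p → Σl (pick₁ (proj₂ p)) (λ q → H (proj₁ p) x (proj₁ q) (proj₂ q)))
                                      (λ p → Σl (pick₂ (proj₂ p)) (λ t → onRest (proj₁ p) (proj₁ t) (proj₁ (proj₂ t)) (proj₂ (proj₂ t)))))) ⟩
      pairs + (pickTwice r (λ a b v → H a x b v) + pickThenPair r onRest)
        ≡⟨ cong₂ (λ u w → pairs + (u + w)) (pickTwice-swap r (λ a b v → H a x b v)) (pick-pair-exchange (suc (suc (suc k))) r onRest) ⟩
      pairs + (pickTwice r (λ a b v → H b x a v) + pairThenPick r onRest)
        ≡⟨ +-exchange pairs (pickTwice r (λ a b v → H b x a v)) (pairThenPick r onRest) ⟩
      pickTwice r (λ a b v → H b x a v) + (pairs + pairThenPick r onRest)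
        ≡⟨ cong (pickTwice r (λ a b v → H b x a v) +_)
                (sym (trans (Σl-cong (pick₂ r) (λ t → Σpick₁-cons x (proj₂ (proj₂ t)) (λ a v → H a (proj₁ t) (proj₁ (proj₂ t)) v)))
                            (Σl-+ (pick₂ r) (λ t → H x (proj₁ t) (proj₁ (proj₂ t)) (proj₂ (proj₂ t)))
                                  (λ t → Σl (pick₁ (proj₂ (proj₂ t))) (λ q → onRest (proj₁ q) (proj₁ t) (proj₁ (proj₂ t)) (proj₂ q)))))) ⟩
      pickTwice r (λ a b v → H b x a v) + Σl (pick₂ r) (λ t → Σl (pick₁ (x ∷ proj₂ (proj₂ t))) (λ q → H (proj₁ q) (proj₁ t) (proj₁ (proj₂ t)) (proj₂ q)))
        ≡⟨ sym (Σpick₂-cons x r (λ a b v → Σl (pick₁ v) (λ q → H (proj₁ q) a b (proj₂ q)))) ⟩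
      pairThenPick (x ∷ r) H ∎
      where
      open ≡-Reasoning
      pairs : ℕ
      pairs = Σl (pick₂ r) (λ t → H x (proj₁ t) (proj₁ (proj₂ t)) (proj₂ (proj₂ t)))
      onRest : A → A → A → Vec A k → ℕ
      onRest a b c v = H a b c (x ∷ v)

    pick₁-Σv : ∀ k (xs : Vec A (suc k)) (h : A → ℕ) →
      All (λ p → Σv xs h ≡ h (proj₁ p) + Σv (proj₂ p) h) (pick₁ xs)
    pick₁-Σv zero (x ∷ []) h = refl ∷ []
    pick₁-Σv (suc k) (x ∷ w ∷ ws) h = refl ∷ AllP.map⁺ (All.map (λ {p} e →
        trans (cong (h x +_) e) (+-exchange (h x) (h (proj₁ p)) _)) (pick₁-Σv k (w ∷ ws) h))

    pick₂-Σv : ∀ k (xs : Vec A k) (h : A → ℕ) →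
      All (λ t → Σv xs h ≡ h (proj₁ t) + h (proj₁ (proj₂ t)) + Σv (proj₂ (proj₂ t)) h) (pick₂ xs)
    pick₂-Σv zero [] h = []
    pick₂-Σv (suc zero) (x ∷ []) h = []
    pick₂-Σv (suc (suc zero)) (x ∷ y ∷ []) h = sym (+-assoc (h x) (h y) 0) ∷ []
    pick₂-Σv (suc (suc (suc k))) (x ∷ y ∷ z ∷ zs) h = AllP.++⁺
      (AllP.map⁺ (All.map (λ {p} e → trans (cong (h x +_) e) (sym (+-assoc (h x) _ _)))
                          (pick₁-Σv (suc k) (y ∷ z ∷ zs) h)))
      (AllP.map⁺ (All.map (λ {t} e → trans (cong (h x +_) e) (+-exchange (h x) (h (proj₁ t) + h (proj₁ (proj₂ t))) _))
                          (pick₂-Σv (suc (suc k)) (y ∷ z ∷ zs) h)))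

module RestrictedMatchings where

  open import Data.Nat using (ℕ; zero; suc; _+_; _*_; _∸_; pred)
  open import Data.Nat.Properties
  open import Data.Bool using (Bool; true; false; not; _∧_)
  open import Data.Bool.ListAction using (and)
  open import Data.Product using (_×_; _,_; proj₁; proj₂)
  open import Data.List using (List; []; _∷_; map)
  open import Data.Vec using (Vec; []; _∷_)
  open import Data.List.Relation.Unary.All as All using (All)
  open import Relation.Binary.PropositionalEquality
  open ListSums
  open Selections
  open RestrictedCount

  -- Perfect matchings of a vector of points, each point labelled true (in L)
  -- or false (in R); a matching is restricted if no pair has both labels true.
  module Restricted {A : Set} (lab : A → Bool) where

    ok : A → A → Bool
    ok x y = not (lab x ∧ lab y)

    restr : List (A × A) → Bool
    restr m = and (map (λ P → not (lab (proj₁ P) ∧ lab (proj₂ P))) m)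

    ΣR : ∀ k → Vec A k → (List (A × A) → ℕ) → ℕ
    ΣR k xs F = Σl (matchings k xs) (λ m → guard (restr m) (F m))

    ΣR-cong : ∀ k (xs : Vec A k) {F G : List (A × A) → ℕ} → (∀ m → F m ≡ G m) → ΣR k xs F ≡ ΣR k xs G
    ΣR-cong k xs e = Σl-cong (matchings k xs) (λ m → cong (guard (restr m)) (e m))

    ΣR-+ : ∀ k (xs : Vec A k) (F G : List (A × A) → ℕ) → ΣR k xs (λ m → F m + G m) ≡ ΣR k xs F + ΣR k xs G
    ΣR-+ k xs F G = trans (Σl-cong (matchings k xs) (λ m → guard-+ (restr m) (F m) (G m))) (Σl-+ (matchings k xs) _ _)

    ΣR-* : ∀ k (xs : Vec A k) (c : ℕ) (F : List (A × A) → ℕ) → ΣR k xs (λ m → c * F m) ≡ c * ΣR k xs F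
    ΣR-* k xs c F = trans (Σl-cong (matchings k xs) (λ m → guard-* (restr m) c (F m))) (Σl-* (matchings k xs) c _)

    ΣR-first : ∀ k (x : A) (xs : Vec A k) (F : List (A × A) → ℕ) →
      ΣR (suc k) (x ∷ xs) F ≡
      Σl (pick₁ xs) (λ p → guard (ok x (proj₁ p)) (ΣR (pred k) (proj₂ p) (λ m → F ((x , proj₁ p) ∷ m))))
    ΣR-first zero x [] F = refl
    ΣR-first (suc k) x (y ∷ ys) F =
      trans (Σl-concatMap (λ p → map ((x , proj₁ p) ∷_) (matchings k (proj₂ p))) (picks (y ∷ ys)) _)
        (Σl-cong (picks (y ∷ ys)) λ p →
          trans (Σl-map ((x , proj₁ p) ∷_) (matchings k (proj₂ p)) _)
           (trans (Σl-cong (matchings k (proj₂ p)) (λ m → guard-∧ (ok x (proj₁ p)) (restr m) (F ((x , proj₁ p) ∷ m))))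
             (sym (Σl-guard (ok x (proj₁ p)) (matchings k (proj₂ p)) _))))

    -- Double counting: summing, over restricted matchings m and pairs P ∈ m,
    -- a weight W P (m without P) is summing, over admissible pairs {x,y} of
    -- points, the restricted matchings of the remaining points.
    pairSum : (A × A → List (A × A) → ℕ) → List (A × A) → ℕ
    pairSum W m = Σl (picksL m) (λ p → W (proj₁ p) (proj₂ p))

    ΣR-pairs : ∀ k (xs : Vec A k) (W : A × A → List (A × A) → ℕ) →
      ΣR k xs (pairSum W) ≡
      Σl (pick₂ xs) (λ t → guard (ok (proj₁ t) (proj₁ (proj₂ t))) (ΣR (pred (pred k)) (proj₂ (proj₂ t)) (W (proj₁ t , proj₁ (proj₂ t)))))
    ΣR-pairs zero [] W = refl
    ΣR-pairs (suc zero) (x ∷ []) W = refl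
    ΣR-pairs (suc (suc zero)) (x ∷ y ∷ []) W with ok x y
    ... | true = refl
    ... | false = refl
    ΣR-pairs (suc (suc (suc k))) (x ∷ r) W = begin
      ΣR (suc (suc (suc k))) (x ∷ r) (pairSum W)
        ≡⟨ ΣR-first (suc (suc k)) x r (pairSum W) ⟩
      Σl (pick₁ r) (λ p → guard (ok x (proj₁ p)) (ΣR (suc k) (proj₂ p) (λ m → pairSum W ((x , proj₁ p) ∷ m))))
        ≡⟨ Σl-cong (pick₁ r) (λ p → cong (guard (ok x (proj₁ p)))
                                 (splitFirstPair p (ΣR-pairs (suc k) (proj₂ p) (λ P m → W P ((x , proj₁ p) ∷ m))))) ⟩
      Σl (pick₁ r) (λ p → guard (ok x (proj₁ p)) (ΣR (suc k) (proj₂ p) (W (x , proj₁ p)) + later p))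
        ≡⟨ trans (Σl-cong (pick₁ r) (λ p → guard-+ (ok x (proj₁ p)) _ (later p))) (Σl-+ (pick₁ r) _ _) ⟩
      withFirst + Σl (pick₁ r) (λ p → guard (ok x (proj₁ p)) (later p))
        ≡⟨ cong (withFirst +_) pairsAvoidingFirst ⟩
      withFirst + Σl (pick₂ r) (λ t → guard (ok (proj₁ t) (proj₁ (proj₂ t))) (ΣR (suc k) (x ∷ proj₂ (proj₂ t)) (W (proj₁ t , proj₁ (proj₂ t)))))
        ≡⟨ sym (Σpick₂-cons x r (λ a b v → guard (ok a b) (ΣR (suc k) v (W (a , b))))) ⟩
      Σl (pick₂ (x ∷ r)) (λ t → guard (ok (proj₁ t) (proj₁ (proj₂ t))) (ΣR (suc k) (proj₂ (proj₂ t)) (W (proj₁ t , proj₁ (proj₂ t))))) ∎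
      where
      open ≡-Reasoning
      withFirst : ℕ
      withFirst = Σl (pick₁ r) (λ p → guard (ok x (proj₁ p)) (ΣR (suc k) (proj₂ p) (W (x , proj₁ p))))
      afterFirst : A → A → A → Vec A (pred k) → ℕ
      afterFirst y a b u = guard (ok a b) (ΣR (pred k) u (λ m → W (a , b) ((x , y) ∷ m)))
      later : A × Vec A (suc k) → ℕ
      later p = Σl (pick₂ (proj₂ p)) (λ t → afterFirst (proj₁ p) (proj₁ t) (proj₁ (proj₂ t)) (proj₂ (proj₂ t)))
      splitFirstPair : ∀ p → ΣR (suc k) (proj₂ p) (pairSum (λ P m → W P ((x , proj₁ p) ∷ m))) ≡ later p →
        ΣR (suc k) (proj₂ p) (λ m → pairSum W ((x , proj₁ p) ∷ m)) ≡ ΣR (suc k) (proj₂ p) (W (x , proj₁ p)) + later p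
      splitFirstPair p ih =
        trans (ΣR-cong (suc k) (proj₂ p) (λ m → cong (W (x , proj₁ p) m +_) (Σl-map _ (picksL m) (λ q → W (proj₁ q) (proj₂ q)))))
        (trans (ΣR-+ (suc k) (proj₂ p) (W (x , proj₁ p)) (pairSum (λ P m → W P ((x , proj₁ p) ∷ m))))
         (cong (ΣR (suc k) (proj₂ p) (W (x , proj₁ p)) +_) ih))
      pairsAvoidingFirst :
        Σl (pick₁ r) (λ p → guard (ok x (proj₁ p)) (later p)) ≡
        Σl (pick₂ r) (λ t → guard (ok (proj₁ t) (proj₁ (proj₂ t))) (ΣR (suc k) (x ∷ proj₂ (proj₂ t)) (W (proj₁ t , proj₁ (proj₂ t)))))
      pairsAvoidingFirst =
        trans (Σl-cong (pick₁ r) (λ p → trans (Σl-guard (ok x (proj₁ p)) (pick₂ (proj₂ p)) _)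
                  (Σl-cong (pick₂ (proj₂ p)) (λ t → guard-comm (ok x (proj₁ p)) (ok (proj₁ t) (proj₁ (proj₂ t))) _))))
        (trans (pick-pair-exchange (suc (suc k)) r (λ y a b u → guard (ok a b) (guard (ok x y) (ΣR (pred k) u (λ m → W (a , b) ((x , y) ∷ m))))))
         (Σl-cong (pick₂ r) (λ t → trans (sym (Σl-guard (ok (proj₁ t) (proj₁ (proj₂ t))) (pick₁ (proj₂ (proj₂ t))) _))
             (cong (guard (ok (proj₁ t) (proj₁ (proj₂ t)))) (sym (ΣR-first k x (proj₂ (proj₂ t)) _))))))

    iL iR : A → ℕ
    iL x = ind (lab x)
    iR x = ind (not (lab x))

    cL cR : ∀ {k} → Vec A k → ℕ
    cL xs = Σv xs iL
    cR xs = Σv xs iR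

    Σv-byLabel : ∀ {k} (r : Vec A k) (φ : Bool → ℕ) → Σv r (λ y → φ (lab y)) ≡ φ true * cL r + φ false * cR r
    Σv-byLabel r φ =
      trans (Σv-cong r (λ y → split (lab y)))
        (trans (Σv-+ r (λ y → φ true * iL y) (λ y → φ false * iR y))
               (cong₂ _+_ (Σv-* r (φ true) iL) (Σv-* r (φ false) iR)))
      where
      split : ∀ b → φ b ≡ φ true * ind b + φ false * ind (not b)
      split true = sym (trans (cong (_+ φ false * 0) (*-identityʳ (φ true))) (trans (cong (φ true +_) (*-zeroʳ (φ false))) (+-identityʳ _)))
      split false = sym (trans (cong (_+ φ false * 1) (*-zeroʳ (φ true))) (*-identityʳ (φ false)))

    ΣR-count : ∀ k (xs : Vec A k) → ΣR k xs (λ _ → 1) ≡ rpm (cL xs) (cR xs)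
    ΣR-count zero [] = refl
    ΣR-count (suc zero) (x ∷ []) with lab x
    ... | true = refl
    ... | false = refl
    ΣR-count (suc (suc k)) (x ∷ r) = begin
      ΣR (suc (suc k)) (x ∷ r) (λ _ → 1)
        ≡⟨ ΣR-first (suc k) x r (λ _ → 1) ⟩
      Σl (pick₁ r) (λ p → guard (ok x (proj₁ p)) (ΣR k (proj₂ p) (λ _ → 1)))
        ≡⟨ Σl-congAll (pick₁ r) (All.zipWith byCounts (pick₁-Σv k r iL , pick₁-Σv k r iR)) ⟩
      Σl (pick₁ r) (λ p → φ (lab (proj₁ p)))
        ≡⟨ trans (Σpick₁ (suc k) r (λ y → φ (lab y))) (Σv-byLabel r φ) ⟩
      φ true * cL r + φ false * cR r
        ≡⟨ firstLabel (lab x) ⟩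
      rpm (iL x + cL r) (iR x + cR r) ∎
      where
      open ≡-Reasoning
      φ : Bool → ℕ
      φ b = guard (not (lab x ∧ b)) (rpm (cL r ∸ ind b) (cR r ∸ ind (not b)))
      byCounts : ∀ {p} → (cL r ≡ iL (proj₁ p) + cL (proj₂ p)) × (cR r ≡ iR (proj₁ p) + cR (proj₂ p)) →
        guard (ok x (proj₁ p)) (ΣR k (proj₂ p) (λ _ → 1)) ≡ φ (lab (proj₁ p))
      byCounts {p} (eL , eR) = cong (guard (ok x (proj₁ p))) (trans (ΣR-count k (proj₂ p))
        (cong₂ rpm (sym (trans (cong (_∸ iL (proj₁ p)) eL) (m+n∸m≡n (iL (proj₁ p)) _)))
                   (sym (trans (cong (_∸ iR (proj₁ p)) eR) (m+n∸m≡n (iR (proj₁ p)) _)))))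
      firstLabel : ∀ c → guard (not (c ∧ true)) (rpm (cL r ∸ 1) (cR r)) * cL r + guard (not (c ∧ false)) (rpm (cL r) (cR r ∸ 1)) * cR r
                       ≡ rpm (ind c + cL r) (ind (not c) + cR r)
      firstLabel true = onlyR (cL r) (cR r)
        where
        onlyR : ∀ a b → 0 * a + rpm a (b ∸ 1) * b ≡ rpm (suc a) b
        onlyR a zero = *-zeroʳ (rpm a 0)
        onlyR a (suc b) = *-comm (rpm a b) (suc b)
      firstLabel false = trans (cong₂ _+_ (*-comm (rpm (cL r ∸ 1) (cR r)) (cL r)) (*-comm (rpm (cL r) (cR r ∸ 1)) (cR r)))
        (trans (cong₂ (λ u v → cL r * rpm u (cR r) + cR r * rpm (cL r) v) (∸1≡pred (cL r)) (∸1≡pred (cR r)))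
               (sym (rpm-firstR (cL r) (cR r))))
        where
        ∸1≡pred : ∀ a → a ∸ 1 ≡ pred a
        ∸1≡pred zero = refl
        ∸1≡pred (suc a) = refl

    ΣR-const : ∀ k (xs : Vec A k) (c : ℕ) → ΣR k xs (λ _ → c) ≡ c * rpm (cL xs) (cR xs)
    ΣR-const k xs c = trans (Σl-cong (matchings k xs) (λ m → guard-ind (restr m) c))
      (trans (Σl-* (matchings k xs) c _) (cong (c *_) (ΣR-count k xs)))

    ΣR-Σ : ∀ k (xs : Vec A k) (w : A × A → ℕ) →
      ΣR k xs (λ m → Σl m w) ≡
      Σl (pick₂ xs) (λ t → guard (ok (proj₁ t) (proj₁ (proj₂ t)))
                                (w (proj₁ t , proj₁ (proj₂ t)) * rpm (cL (proj₂ (proj₂ t))) (cR (proj₂ (proj₂ t)))))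
    ΣR-Σ k xs w = trans (ΣR-cong k xs (λ m → sym (picksL-Σ m w)))
      (trans (ΣR-pairs k xs (λ P _ → w P))
        (Σl-cong (pick₂ xs) (λ t → cong (guard (ok (proj₁ t) (proj₁ (proj₂ t)))) (ΣR-const (pred (pred k)) (proj₂ (proj₂ t)) _))))

    ΣR-ΣΣ : ∀ k (xs : Vec A k) (w : A × A → A × A → ℕ) →
      ΣR k xs (λ m → Σl (picksL m) (λ p → Σl (proj₂ p) (w (proj₁ p)))) ≡
      Σl (pick₂ xs) (λ t → guard (ok (proj₁ t) (proj₁ (proj₂ t)))
         (Σl (pick₂ (proj₂ (proj₂ t))) (λ t' → guard (ok (proj₁ t') (proj₁ (proj₂ t')))
            (w (proj₁ t , proj₁ (proj₂ t)) (proj₁ t' , proj₁ (proj₂ t')) * rpm (cL (proj₂ (proj₂ t'))) (cR (proj₂ (proj₂ t')))))))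
    ΣR-ΣΣ k xs w = trans (ΣR-pairs k xs (λ P m → Σl m (w P)))
      (Σl-cong (pick₂ xs) (λ t → cong (guard (ok (proj₁ t) (proj₁ (proj₂ t))))
         (ΣR-Σ (pred (pred k)) (proj₂ (proj₂ t)) (w (proj₁ t , proj₁ (proj₂ t))))))

module FinSums where

  open import Data.Nat using (ℕ; zero; suc; _+_; _*_)
  open import Data.Nat.Properties using (+-identityʳ)
  open import Data.Bool using (Bool; true)
  open import Data.Product using (_,_; proj₁)
  open import Data.List using (List; []; _∷_; map; upTo; allFin; tabulate; length)
  open import Data.List.Properties using (length-upTo)
  open import Data.Fin using (Fin; zero; suc; _≟_)
  open import Data.Fin.Properties using (suc-injective)
  open import Data.Empty using (⊥-elim)
  open import Relation.Nullary.Decidable using (⌊_⌋; yes; no)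
  open import Relation.Binary.PropositionalEquality
  open ListSums

  infix 10 _=F_
  _=F_ : ∀ {n} → Fin n → Fin n → Bool
  i =F j = ⌊ i ≟ j ⌋

  =F-refl : ∀ {n} (i : Fin n) → (i =F i) ≡ true
  =F-refl i with i ≟ i
  ... | yes _ = refl
  ... | no ¬p = ⊥-elim (¬p refl)

  =F-sound : ∀ {n} (i j : Fin n) → (i =F j) ≡ true → i ≡ j
  =F-sound i j e with i ≟ j
  ... | yes p = p
  =F-sound i j () | no _

  =F-sym : ∀ {n} (i j : Fin n) → (i =F j) ≡ (j =F i)
  =F-sym i j with i ≟ j | j ≟ i
  ... | yes _ | yes _ = refl
  ... | no _ | no _ = refl
  ... | yes p | no ¬q = ⊥-elim (¬q (sym p))
  ... | no ¬p | yes q = ⊥-elim (¬p (sym q))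

  =F-suc : ∀ {n} (i j : Fin n) → (suc i =F suc j) ≡ (i =F j)
  =F-suc i j with i ≟ j | suc i ≟ suc j
  ... | yes _ | yes _ = refl
  ... | no _ | no _ = refl
  ... | yes p | no ¬q = ⊥-elim (¬q (cong suc p))
  ... | no ¬p | yes q = ⊥-elim (¬p (suc-injective q))

  private
    Σtab : ∀ {B : Set} {n} (f : Fin n → B) (h : B → ℕ) → Σl (tabulate f) h ≡ Σl (allFin n) (λ i → h (f i))
    Σtab {n = zero} f h = refl
    Σtab {n = suc n} f h =
      cong (h (f zero) +_) (trans (Σtab (λ i → f (suc i)) h) (sym (Σtab suc (λ i → h (f i)))))

  Σfin-suc : ∀ {n} (h : Fin (suc n) → ℕ) → Σl (allFin (suc n)) h ≡ h zero + Σl (allFin n) (λ i → h (suc i))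
  Σfin-suc h = cong (h zero +_) (Σtab suc h)

  Σ-delta : ∀ {n} (j : Fin n) (F : Fin n → ℕ) → Σl (allFin n) (λ i → guard (j =F i) (F i)) ≡ F j
  Σ-delta {suc n} zero F =
    trans (Σfin-suc (λ i → guard (zero =F i) (F i))) (trans (cong (F zero +_) (Σl-zero (allFin n))) (+-identityʳ _))
  Σ-delta {suc n} (suc j) F = trans (Σfin-suc (λ i → guard (suc j =F i) (F i)))
    (trans (Σl-cong (allFin n) (λ i → cong (λ b → guard b (F (suc i))) (=F-suc j i))) (Σ-delta j (λ i → F (suc i))))

  Σpoints : ∀ {n} (d : Fin n → ℕ) (h : Fin n → ℕ) → Σl (points d) (λ p → h (proj₁ p)) ≡ Σl (allFin n) (λ i → d i * h i)
  Σpoints {n} d h = trans (Σl-concatMap (λ i → map (i ,_) (upTo (d i))) (allFin n) _)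
    (Σl-cong (allFin n) (λ i → trans (Σl-map (i ,_) (upTo (d i)) _)
      (trans (Σconst (upTo (d i)) (h i)) (cong (_* h i) (length-upTo (d i))))))
    where
    Σconst : (l : List ℕ) (c : ℕ) → Σl l (λ _ → c) ≡ length l * c
    Σconst [] c = refl
    Σconst (x ∷ l) c = cong (c +_) (Σconst l c)

module PairingModel where

  open import Data.Nat using (ℕ; zero; suc; _+_; _*_; _∸_; _≤_; z≤n; s≤s; _⊔_)
  open import Data.Nat.Properties
  open import Data.Nat.ListAction using (sum)
  open import Data.Bool using (Bool; true; false; not; _∧_; _∨_; _xor_; if_then_else_)
  open import Data.Bool.Properties using (∧-comm; xor-comm; ∧-zeroʳ)
  open import Data.Product using (_×_; _,_; proj₁; proj₂)
  open import Data.Sum using (_⊎_; inj₁; inj₂)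
  open import Data.List using (List; []; _∷_; map; allFin; length; foldr)
  open import Data.Vec using (Vec; []; _∷_; fromList)
  open import Data.Fin using (Fin)
  open import Data.List.Relation.Unary.All as All using (All)
  open import Data.List.Relation.Unary.Any using (here; there)
  open import Data.List.Membership.Propositional using (_∈_)
  open import Data.List.Membership.Propositional.Properties using (∈-map⁺; ∈-allFin)
  open import Data.Empty using (⊥; ⊥-elim)
  open import Relation.Binary.PropositionalEquality
  open import Data.Nat.Tactic.RingSolver using (solve-∀)
  open ListSums
  open Selections
  open RestrictedCount
  open RestrictedMatchings
  open FinSums

  -- Exact formulas for the pairing model of one instance (L, R, d): the
  -- restricted pairings are the restricted matchings of the vector of all
  -- points, labelled by membership of their vertex in L.
  module Instance {n : ℕ} (inL : Fin n → Bool) (d : Fin n → ℕ) where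

    vtx : Point n → Fin n
    vtx = proj₁

    open Restricted (λ (p : Point n) → inL (vtx p)) public

    K : ℕ
    K = length (points d)

    pts : Vec (Point n) K
    pts = fromList (points d)

    Σpts : (h : Fin n → ℕ) → Σv pts (λ p → h (vtx p)) ≡ Σl (allFin n) (λ i → d i * h i)
    Σpts h = trans (fromList-Σ (points d)) (Σpoints d h)
      where
      fromList-Σ : (l : List (Point n)) → Σv (fromList l) (λ p → h (vtx p)) ≡ Σl l (λ p → h (vtx p))
      fromList-Σ [] = refl
      fromList-Σ (x ∷ l) = cong (h (vtx x) +_) (fromList-Σ l)

    M₁L-Σ : M₁L inL d ≡ Σl (allFin n) (λ i → d i * ind (inL i))
    M₁L-Σ = trans (sum-map _ (allFin n)) (Σl-cong (allFin n) (λ i → guard-ind (inL i) (d i)))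

    M₁R-Σ : M₁R inL d ≡ Σl (allFin n) (λ i → d i * ind (not (inL i)))
    M₁R-Σ = trans (sum-map _ (allFin n)) (Σl-cong (allFin n) (λ i → byLabel (inL i)))
      where
      byLabel : ∀ b {x} → (if b then 0 else x) ≡ x * ind (not b)
      byLabel true {x} = sym (*-zeroʳ x)
      byLabel false {x} = sym (*-identityʳ x)

    cL-pts : cL pts ≡ M₁L inL d
    cL-pts = trans (Σpts (λ i → ind (inL i))) (sym M₁L-Σ)

    cR-pts : cR pts ≡ M₁R inL d
    cR-pts = trans (Σpts (λ i → ind (not (inL i)))) (sym M₁R-Σ)

    RP : List (Pairing n)
    RP = restrictedPairings inL d

    Σ-restricted : (X : Pairing n → ℕ) → sum (map X RP) ≡ ΣR K pts X
    Σ-restricted X = trans (sum-map X RP) (Σl-filter (isRestricted inL) (matchings K pts) X)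

    #restricted : length RP ≡ rpm (M₁L inL d) (M₁R inL d)
    #restricted = trans (length-Σ RP) (trans (Σl-filter (isRestricted inL) (matchings K pts) (λ _ → 1))
      (trans (ΣR-count K pts) (cong₂ rpm cL-pts cR-pts)))

    pick₂-labels : ∀ {k} (v : Vec (Point n) k) →
      All (λ t → cL v ≡ iL (proj₁ t) + iL (proj₁ (proj₂ t)) + cL (proj₂ (proj₂ t)) ×
                 cR v ≡ iR (proj₁ t) + iR (proj₁ (proj₂ t)) + cR (proj₂ (proj₂ t))) (pick₂ v)
    pick₂-labels {k} v = All.zip (pick₂-Σv k v iL , pick₂-Σv k v iR)

    cV : ∀ {k} → Fin n → Vec (Point n) k → ℕ
    cV i v = Σv v (λ p → ind (vtx p =F i))

    cV-pts : ∀ i → cV i pts ≡ d i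
    cV-pts i = trans (Σpts (λ j → ind (j =F i))) (trans (Σl-cong (allFin n) atVertex) (Σ-delta i d))
      where
      atVertex : ∀ j → d j * ind (j =F i) ≡ guard (i =F j) (d j)
      atVertex j = trans (cong (λ b → d j * ind b) (=F-sym j i)) (sym (guard-ind (i =F j) (d j)))

    ΣP-sameVertex : ∀ {k} (v : Vec (Point n) k) (F : Fin n → ℕ) →
      2 * ΣP v (λ p q → ind (vtx p =F vtx q) * F (vtx p)) + Σv v (λ p → F (vtx p)) ≡
      Σl (allFin n) (λ i → cV i v * cV i v * F i)
    ΣP-sameVertex [] F = sym (Σl-zero (allFin n))
    ΣP-sameVertex (x ∷ r) F = begin
      2 * (Σv r (same x) + ΣP r same) + (F a + Σv r (λ p → F (vtx p)))
        ≡⟨ cong (λ u → 2 * (u + ΣP r same) + (F a + Σv r (λ p → F (vtx p)))) withFirst ⟩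
      2 * (F a * cV a r + ΣP r same) + (F a + Σv r (λ p → F (vtx p)))
        ≡⟨ regroup (F a) (cV a r) (ΣP r same) (Σv r (λ p → F (vtx p))) ⟩
      (2 * cV a r + 1) * F a + (2 * ΣP r same + Σv r (λ p → F (vtx p)))
        ≡⟨ cong ((2 * cV a r + 1) * F a +_) (ΣP-sameVertex r F) ⟩
      (2 * cV a r + 1) * F a + Σl (allFin n) (λ i → cV i r * cV i r * F i)
        ≡⟨ cong (_+ Σl (allFin n) (λ i → cV i r * cV i r * F i)) (sym (Σ-delta a (λ i → (2 * cV i r + 1) * F i))) ⟩
      Σl (allFin n) (λ i → guard (a =F i) ((2 * cV i r + 1) * F i)) + Σl (allFin n) (λ i → cV i r * cV i r * F i)
        ≡⟨ sym (trans (Σl-cong (allFin n) (λ i → square (a =F i) (cV i r) (F i))) (Σl-+ (allFin n) _ _)) ⟩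
      Σl (allFin n) (λ i → cV i (x ∷ r) * cV i (x ∷ r) * F i) ∎
      where
      open ≡-Reasoning
      a : Fin n
      a = vtx x
      same : Point n → Point n → ℕ
      same p q = ind (vtx p =F vtx q) * F (vtx p)
      withFirst : Σv r (same x) ≡ F a * cV a r
      withFirst = trans (Σv-cong r (λ q → trans (cong (λ b → ind b * F a) (=F-sym a (vtx q))) (*-comm (ind (vtx q =F a)) (F a))))
                        (Σv-* r (F a) _)
      regroup : ∀ Fa c P S → 2 * (Fa * c + P) + (Fa + S) ≡ (2 * c + 1) * Fa + (2 * P + S)
      regroup = solve-∀
      square : ∀ (b : Bool) c Fi → (ind b + c) * (ind b + c) * Fi ≡ guard b ((2 * c + 1) * Fi) + c * c * Fi
      square true c Fi = expand c Fi
        where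
        expand : ∀ c Fi → (1 + c) * (1 + c) * Fi ≡ (2 * c + 1) * Fi + c * c * Fi
        expand = solve-∀
      square false c Fi = refl

    -- Loops are pairs of points at one vertex, which must lie in R.
    inR : Fin n → ℕ
    inR i = ind (not (inL i))

    loopWeight : ℕ
    loopWeight = ΣP pts (λ p q → ind (vtx p =F vtx q) * inR (vtx p))

    ΣB₀ : ΣR K pts (B₀ inL) ≡ loopWeight * rpm (cL pts) (cR pts ∸ 2)
    ΣB₀ = begin
      ΣR K pts (B₀ inL)
        ≡⟨ ΣR-cong K pts (countᵇ-Σ (isLoop inL)) ⟩
      ΣR K pts (λ m → Σl m (λ P → ind (isLoop inL P)))
        ≡⟨ ΣR-Σ K pts (λ P → ind (isLoop inL P)) ⟩
      Σl (pick₂ pts) (λ t → guard (ok (proj₁ t) (proj₁ (proj₂ t)))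
                                 (ind (vtx (proj₁ t) =F vtx (proj₁ (proj₂ t))) * rpm (cL (proj₂ (proj₂ t))) (cR (proj₂ (proj₂ t)))))
        ≡⟨ Σl-congAll (pick₂ pts) (All.map (λ {t} e → loopTerm (proj₁ t) (proj₁ (proj₂ t)) (proj₂ (proj₂ t)) (proj₁ e) (proj₂ e))
                                           (pick₂-labels pts)) ⟩
      Σl (pick₂ pts) (λ t → ind (vtx (proj₁ t) =F vtx (proj₁ (proj₂ t))) * inR (vtx (proj₁ t)) * rpm (cL pts) (cR pts ∸ 2))
        ≡⟨ trans (Σl-*ʳ (pick₂ pts) _ _) (cong (_* rpm (cL pts) (cR pts ∸ 2)) (Σpick₂ K pts _)) ⟩
      loopWeight * rpm (cL pts) (cR pts ∸ 2) ∎
      where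
      open ≡-Reasoning
      -- a loop at an R-vertex leaves all L-points and two fewer R-points
      loopTerm : ∀ {j} (p q : Point n) (t : Vec (Point n) j) →
        cL pts ≡ iL p + iL q + cL t → cR pts ≡ iR p + iR q + cR t →
        guard (ok p q) (ind (vtx p =F vtx q) * rpm (cL t) (cR t)) ≡ ind (vtx p =F vtx q) * inR (vtx p) * rpm (cL pts) (cR pts ∸ 2)
      loopTerm (i , x) (j , y) t hL hR with i =F j in e
      ... | false = guard-* (ok (i , x) (j , y)) 0 (rpm (cL t) (cR t))
      ... | true with =F-sound i j e
      ... | refl with inL i
      ... | true = refl
      ... | false = cong₂ (λ u w → 1 * rpm u w) (sym hL) (sym (cong (_∸ 2) hR))

    -- Each R-vertex of degree dᵢ carries dᵢ(dᵢ-1)/2 possible loops.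
    loopWeight-M₂R : 2 * loopWeight ≡ M₂R inL d
    loopWeight-M₂R = +-cancelʳ-≡ (Σl (allFin n) (λ i → d i * inR i)) (2 * loopWeight) (M₂R inL d) (begin
      2 * loopWeight + Σl (allFin n) (λ i → d i * inR i)
        ≡⟨ cong (2 * loopWeight +_) (sym (Σpts inR)) ⟩
      2 * loopWeight + Σv pts (λ p → inR (vtx p))
        ≡⟨ ΣP-sameVertex pts inR ⟩
      Σl (allFin n) (λ i → cV i pts * cV i pts * inR i)
        ≡⟨ Σl-cong (allFin n) (λ i → cong (λ u → u * u * inR i) (cV-pts i)) ⟩
      Σl (allFin n) (λ i → d i * d i * inR i)
        ≡⟨ Σl-cong (allFin n) (λ i → split (inL i) (d i)) ⟩
      Σl (allFin n) (λ i → (if inL i then 0 else d i * (d i ∸ 1)) + d i * inR i)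
        ≡⟨ Σl-+ (allFin n) _ _ ⟩
      Σl (allFin n) (λ i → if inL i then 0 else d i * (d i ∸ 1)) + Σl (allFin n) (λ i → d i * inR i)
        ≡⟨ cong (_+ Σl (allFin n) (λ i → d i * inR i)) (sym (sum-map _ (allFin n))) ⟩
      M₂R inL d + Σl (allFin n) (λ i → d i * inR i) ∎)
      where
      open ≡-Reasoning
      split : ∀ b x → x * x * ind (not b) ≡ (if b then 0 else x * (x ∸ 1)) + x * ind (not b)
      split true x = trans (*-zeroʳ (x * x)) (sym (*-zeroʳ x))
      split false zero = refl
      split false (suc x) = expand x
        where
        expand : ∀ x → suc x * suc x * 1 ≡ suc x * x + suc x * 1
        expand = solve-∀

    sameEnds : Fin n → Fin n → Fin n → Fin n → Bool
    sameEnds i j k l = (i =F k ∧ j =F l) ∨ (i =F l ∧ j =F k)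

    sameEnds-sound : ∀ i j k l → sameEnds i j k l ≡ true → (i ≡ k × j ≡ l) ⊎ (i ≡ l × j ≡ k)
    sameEnds-sound i j k l e with i =F k in e₁ | j =F l in e₂ | i =F l in e₃ | j =F k in e₄
    ... | true | true | _ | _ = inj₁ (=F-sound i k e₁ , =F-sound j l e₂)
    ... | true | false | true | true = inj₂ (=F-sound i l e₃ , =F-sound j k e₄)
    ... | false | _ | true | true = inj₂ (=F-sound i l e₃ , =F-sound j k e₄)

    sameEnds-sym : ∀ i j k l → sameEnds k l i j ≡ sameEnds i j k l
    sameEnds-sym i j k l rewrite =F-sym k i | =F-sym l j | =F-sym k j | =F-sym l i =
      cong ((i =F k ∧ j =F l) ∨_) (∧-comm (j =F k) (i =F l))

    sameEnds-ind : ∀ i j k l → (i ≡ j → ⊥) →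
      ind (sameEnds i j k l) ≡ ind (k =F i) * ind (l =F j) + ind (k =F j) * ind (l =F i)
    sameEnds-ind i j k l i≢j rewrite =F-sym k i | =F-sym l j | =F-sym k j | =F-sym l i =
      disjoint (i =F k) (j =F l) (i =F l) (j =F k) (λ a e → i≢j (trans (=F-sound i k a) (sym (=F-sound j k e))))
      where
      disjoint : ∀ a b c e → (a ≡ true → e ≡ true → ⊥) → ind ((a ∧ b) ∨ (c ∧ e)) ≡ ind a * ind b + ind e * ind c
      disjoint true b c true h = ⊥-elim (h refl refl)
      disjoint true true c false h = refl
      disjoint true false true false h = refl
      disjoint true false false false h = refl
      disjoint false b true true h = refl
      disjoint false b true false h = refl
      disjoint false b false true h = refl
      disjoint false b false false h = refl

    -- φ i = dᵢ - 1 points of vertex i remain once one of them is used.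
    φ : Fin n → ℕ
    φ i = d i ∸ 1

    pick₂-vertices : All (λ t → ∀ i → cV i pts ≡ ind (vtx (proj₁ t) =F i) + ind (vtx (proj₁ (proj₂ t)) =F i) + cV i (proj₂ (proj₂ t)))
                         (pick₂ pts)
    pick₂-vertices = All.tabulate (λ {t} t∈ i → All.lookup (pick₂-Σv K pts (λ p → ind (vtx p =F i))) t∈)

    remainingAt : ∀ i j → (i ≡ j → ⊥) → ∀ {k} (t : Vec (Point n) k) →
      cV i pts ≡ ind (i =F i) + ind (j =F i) + cV i t → cV i t ≡ φ i
    remainingAt i j i≢j t h with j =F i in e
    ... | true = ⊥-elim (i≢j (sym (=F-sound j i e)))
    ... | false = sym (cong (_∸ 1) (trans (sym (cV-pts i)) (trans h (cong (λ b → ind b + 0 + cV i t) (=F-refl i)))))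

    ΣP-joining : ∀ i j → (i ≡ j → ⊥) → ∀ {k} (t : Vec (Point n) k) →
      ΣP t (λ u v → ind (sameEnds i j (vtx u) (vtx v))) ≡ cV i t * cV j t
    ΣP-joining i j i≢j t = begin
      ΣP t (λ u v → ind (sameEnds i j (vtx u) (vtx v)))
        ≡⟨ ΣP-cong t (λ u v → sameEnds-ind i j (vtx u) (vtx v) i≢j) ⟩
      ΣP t (λ u v → atI u * atJ v + atJ u * atI v)
        ≡⟨ sym (trans (cong (ΣP t (λ u v → atI u * atJ v + atJ u * atI v) +_) noPointAtBoth) (+-identityʳ _)) ⟩
      ΣP t (λ u v → atI u * atJ v + atJ u * atI v) + Σv t (λ u → atI u * atJ u)
        ≡⟨ ΣP-product t atI atJ ⟩
      cV i t * cV j t ∎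
      where
      open ≡-Reasoning
      atI atJ : Point n → ℕ
      atI u = ind (vtx u =F i)
      atJ u = ind (vtx u =F j)
      notBoth : ∀ u → atI u * atJ u ≡ 0
      notBoth (m , _) with m =F i in e₁ | m =F j in e₂
      ... | true | true = ⊥-elim (i≢j (trans (sym (=F-sound m i e₁)) (=F-sound m j e₂)))
      ... | true | false = refl
      ... | false | _ = refl
      noPointAtBoth : Σv t (λ u → atI u * atJ u) ≡ 0
      noPointAtBoth = trans (Σv-cong t notBoth) (Σv-zero t)

    -- A class of pairs {i,j} of distinct vertices such that every pair of points
    -- joining them has nL endpoints in L and nR in R; a double pair over the
    -- class is two pairs of points joining the same vertex pair of the class.
    record PairClass : Set where
      field
        cls : Fin n → Fin n → Bool
        cls-sym : ∀ i j → cls i j ≡ cls j i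
        cls-irrefl : ∀ i → cls i i ≡ false
        nL nR : ℕ
        cls-labels : ∀ i j → cls i j ≡ true →
          not (inL i ∧ inL j) ≡ true × ind (inL i) + ind (inL j) ≡ nL × inR i + inR j ≡ nR

      doubleOver : (Point n × Point n) × (Point n × Point n) → Bool
      doubleOver (P , Q) = cls (vtx (proj₁ P)) (vtx (proj₂ P)) ∧ sameEnds (vtx (proj₁ P)) (vtx (proj₂ P)) (vtx (proj₁ Q)) (vtx (proj₂ Q))

      cls-distinct : ∀ i j → cls i j ≡ true → i ≡ j → ⊥
      cls-distinct i .i e refl with trans (sym e) (cls-irrefl i)
      ... | ()

      doubleOver-sym : ∀ P Q → doubleOver (P , Q) ≡ doubleOver (Q , P)
      doubleOver-sym ((i , _) , (j , _)) ((k , _) , (l , _)) rewrite sameEnds-sym i j k l with sameEnds i j k l in e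
      ... | false = trans (∧-zeroʳ (cls i j)) (sym (∧-zeroʳ (cls k l)))
      ... | true with sameEnds-sound i j k l e
      ... | inj₁ (refl , refl) = refl
      ... | inj₂ (refl , refl) = cong (_∧ true) (cls-sym i j)

      doubleOver-labels : ∀ p q u v → doubleOver ((p , q) , (u , v)) ≡ true →
        ok p q ≡ true × ok u v ≡ true ×
        iL p + iL q ≡ nL × iR p + iR q ≡ nR × iL u + iL v ≡ nL × iR u + iR v ≡ nR
      doubleOver-labels (i , _) (j , _) (k , _) (l , _) h with cls i j in e | sameEnds i j k l in e'
      ... | true | true with sameEnds-sound i j k l e' | cls-labels i j e | cls-labels j i (trans (sym (cls-sym i j)) e)
      ...   | inj₁ (refl , refl) | o , a , b | _ = o , o , a , b , a , b
      ...   | inj₂ (refl , refl) | o , a , b | o' , a' , b' = o , o' , a , b , a' , b'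

      twiceCount : (W : (Point n × Point n) × (Point n × Point n) → Bool) → (∀ PQ → W PQ ≡ doubleOver PQ) →
        ∀ m → 2 * countᵇ W (pairsOf m) ≡ Σl (picksL m) (λ p → Σl (proj₂ p) (λ Q → ind (W (proj₁ p , Q))))
      twiceCount W W≡ m =
        trans (cong (λ u → u + (u + 0)) (countᵇ-Σ W (pairsOf m)))
        (trans (cong (Σl (pairsOf m) (λ PQ → ind (W PQ)) +_)
                 (trans (+-identityʳ _) (Σl-cong (pairsOf m) (λ PQ → cong ind (W-sym (proj₁ PQ) (proj₂ PQ))))))
               (sym (picksL-pairs m (λ P Q → ind (W (P , Q))))))
        where
        W-sym : ∀ P Q → W (P , Q) ≡ W (Q , P)
        W-sym P Q = trans (W≡ (P , Q)) (trans (doubleOver-sym P Q) (sym (W≡ (Q , P))))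

      -- Removing the four points of a double pair leaves all other points,
      -- whatever the double pair is.
      doubleTerm : (W : (Point n × Point n) × (Point n × Point n) → Bool) → (∀ PQ → W PQ ≡ doubleOver PQ) →
        ∀ p q u v {j j'} (t : Vec (Point n) j) (t' : Vec (Point n) j') →
        cL pts ≡ iL p + iL q + cL t → cR pts ≡ iR p + iR q + cR t →
        cL t ≡ iL u + iL v + cL t' → cR t ≡ iR u + iR v + cR t' →
        guard (ok p q) (guard (ok u v) (ind (W ((p , q) , (u , v))) * rpm (cL t') (cR t')))
          ≡ ind (W ((p , q) , (u , v))) * rpm (cL pts ∸ (nL + nL)) (cR pts ∸ (nR + nR))
      doubleTerm W W≡ p q u v t t' h₁ h₂ h₃ h₄ with W ((p , q) , (u , v)) in e
      ... | false = trans (cong (guard (ok p q)) (guard-* (ok u v) 0 (rpm (cL t') (cR t')))) (guard-* (ok p q) 0 0)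
      ... | true with doubleOver-labels p q u v (trans (sym (W≡ _)) e)
      ... | o₁ , o₂ , a₁ , b₁ , a₂ , b₂ rewrite o₁ | o₂ =
        cong₂ (λ a b → 1 * rpm a b) (remaining {cL pts} {iL p} {iL q} {cL t} {iL u} {iL v} {cL t'} nL h₁ h₃ a₁ a₂)
                                    (remaining {cR pts} {iR p} {iR q} {cR t} {iR u} {iR v} {cR t'} nR h₂ h₄ b₁ b₂)
        where
        remaining : ∀ {A₀ x y c u v c'} cl → A₀ ≡ x + y + c → c ≡ u + v + c' → x + y ≡ cl → u + v ≡ cl → c' ≡ A₀ ∸ (cl + cl)
        remaining {A₀} {x} {y} {c} {u} {v} {c'} cl e₁ e₂ s₁ s₂ =
          sym (trans (cong (_∸ (cl + cl)) (trans e₁ (trans (cong₂ _+_ s₁ (trans e₂ (cong (_+ c') s₂))) (sym (+-assoc cl cl c')))))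
                     (m+n∸m≡n (cl + cl) c'))

      ΣR-doubles : (W : (Point n × Point n) × (Point n × Point n) → Bool) → (∀ PQ → W PQ ≡ doubleOver PQ) →
        2 * ΣR K pts (λ m → countᵇ W (pairsOf m)) ≡
        Σl (pick₂ pts) (λ t → Σl (pick₂ (proj₂ (proj₂ t)))
             (λ t' → ind (W ((proj₁ t , proj₁ (proj₂ t)) , (proj₁ t' , proj₁ (proj₂ t'))))))
          * rpm (cL pts ∸ (nL + nL)) (cR pts ∸ (nR + nR))
      ΣR-doubles W W≡ =
        trans (sym (ΣR-* K pts 2 _))
        (trans (ΣR-cong K pts (twiceCount W W≡))
        (trans (ΣR-ΣΣ K pts (λ P Q → ind (W (P , Q))))
        (trans (Σl-congAll (pick₂ pts) (All.map (λ {t} e → outer t e) (pick₂-labels pts)))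
               (Σl-*ʳ (pick₂ pts) _ _))))
        where
        outer : ∀ t → (cL pts ≡ iL (proj₁ t) + iL (proj₁ (proj₂ t)) + cL (proj₂ (proj₂ t))) ×
                      (cR pts ≡ iR (proj₁ t) + iR (proj₁ (proj₂ t)) + cR (proj₂ (proj₂ t))) →
          guard (ok (proj₁ t) (proj₁ (proj₂ t))) (Σl (pick₂ (proj₂ (proj₂ t))) (λ t' →
            guard (ok (proj₁ t') (proj₁ (proj₂ t')))
              (ind (W ((proj₁ t , proj₁ (proj₂ t)) , (proj₁ t' , proj₁ (proj₂ t')))) * rpm (cL (proj₂ (proj₂ t'))) (cR (proj₂ (proj₂ t'))))))
          ≡ Σl (pick₂ (proj₂ (proj₂ t))) (λ t' → ind (W ((proj₁ t , proj₁ (proj₂ t)) , (proj₁ t' , proj₁ (proj₂ t')))))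
              * rpm (cL pts ∸ (nL + nL)) (cR pts ∸ (nR + nR))
        outer t (e₁ , e₂) = trans (Σl-guard (ok (proj₁ t) (proj₁ (proj₂ t))) (pick₂ (proj₂ (proj₂ t))) _)
          (trans (Σl-congAll (pick₂ (proj₂ (proj₂ t))) (All.map (λ {t'} e' →
              doubleTerm W W≡ (proj₁ t) (proj₁ (proj₂ t)) (proj₁ t') (proj₁ (proj₂ t')) (proj₂ (proj₂ t)) (proj₂ (proj₂ t'))
                e₁ e₂ (proj₁ e') (proj₂ e')) (pick₂-labels (proj₂ (proj₂ t)))))
            (Σl-*ʳ (pick₂ (proj₂ (proj₂ t))) _ _))

      -- Given the first pair, joining i and j in the class, the second pair of
      -- a double pair joins one of the φ i points left at i to one of the φ j at j.
      doubleCount : (W : (Point n × Point n) × (Point n × Point n) → Bool) → (∀ PQ → W PQ ≡ doubleOver PQ) →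
        Σl (pick₂ pts) (λ t → Σl (pick₂ (proj₂ (proj₂ t)))
             (λ t' → ind (W ((proj₁ t , proj₁ (proj₂ t)) , (proj₁ t' , proj₁ (proj₂ t'))))))
          ≡ ΣP pts (λ p q → ind (cls (vtx p) (vtx q)) * (φ (vtx p) * φ (vtx q)))
      doubleCount W W≡ =
        trans (Σl-congAll (pick₂ pts) (All.map (λ {t} h → perFirstPair t h) pick₂-vertices))
              (Σpick₂ K pts (λ p q → ind (cls (vtx p) (vtx q)) * (φ (vtx p) * φ (vtx q))))
        where
        perFirstPair : ∀ t → (∀ i → cV i pts ≡ ind (vtx (proj₁ t) =F i) + ind (vtx (proj₁ (proj₂ t)) =F i) + cV i (proj₂ (proj₂ t))) →
          Σl (pick₂ (proj₂ (proj₂ t))) (λ t' → ind (W ((proj₁ t , proj₁ (proj₂ t)) , (proj₁ t' , proj₁ (proj₂ t')))))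
            ≡ ind (cls (vtx (proj₁ t)) (vtx (proj₁ (proj₂ t)))) * (φ (vtx (proj₁ t)) * φ (vtx (proj₁ (proj₂ t))))
        perFirstPair ((i , x) , (j , y) , r) h =
          trans (Σpick₂ _ r (λ u v → ind (W (((i , x) , (j , y)) , (u , v)))))
                (trans (ΣP-cong r (λ u v → cong ind (W≡ (((i , x) , (j , y)) , (u , v))))) (byClass refl))
          where
          byClass : ∀ {b} → cls i j ≡ b →
            ΣP r (λ u v → ind (b ∧ sameEnds i j (vtx u) (vtx v))) ≡ ind b * (φ i * φ j)
          byClass {false} _ = ΣP-zero r
          byClass {true} e = begin
            ΣP r (λ u v → ind (sameEnds i j (vtx u) (vtx v)))  ≡⟨ ΣP-joining i j i≢j r ⟩
            cV i r * cV j r                                     ≡⟨ cong₂ _*_ (remainingAt i j i≢j r (h i)) (remainingAt j i (λ q → i≢j (sym q)) r hj) ⟩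
            φ i * φ j                                           ≡⟨ sym (*-identityˡ (φ i * φ j)) ⟩
            1 * (φ i * φ j) ∎
            where
            open ≡-Reasoning
            i≢j : i ≡ j → ⊥
            i≢j = cls-distinct i j e
            hj : cV j pts ≡ ind (j =F j) + ind (i =F j) + cV j r
            hj = trans (h j) (cong (_+ cV j r) (+-comm (ind (i =F j)) (ind (j =F j))))

    open PairClass

    private
      ∧-reassoc : ∀ a b c → ((a ∧ b) ∧ c) ≡ ((a ∧ c) ∧ b)
      ∧-reassoc true true true = refl
      ∧-reassoc true true false = refl
      ∧-reassoc true false true = refl
      ∧-reassoc true false false = refl
      ∧-reassoc false b c = refl

      ∧-true : ∀ a {b} → (a ∧ b) ≡ true → a ≡ true × b ≡ true
      ∧-true true {true} _ = refl , refl

    mixedClass : PairClass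
    mixedClass = record
      { cls = λ i j → not (i =F j) ∧ (inL i xor inL j)
      ; cls-sym = λ i j → cong₂ (λ a b → not a ∧ b) (=F-sym i j) (xor-comm (inL i) (inL j))
      ; cls-irrefl = λ i → cong (λ b → not b ∧ (inL i xor inL i)) (=F-refl i)
      ; nL = 1
      ; nR = 1
      ; cls-labels = λ i j e → oneInL (inL i) (inL j) (proj₂ (∧-true (not (i =F j)) e))
      }
      where
      oneInL : ∀ a b → (a xor b) ≡ true → not (a ∧ b) ≡ true × ind a + ind b ≡ 1 × ind (not a) + ind (not b) ≡ 1
      oneInL true false _ = refl , refl , refl
      oneInL false true _ = refl , refl , refl

    isMixed≡ : ∀ PQ → isMixed inL PQ ≡ doubleOver mixedClass PQ
    isMixed≡ (((i , _) , (j , _)) , Q) = ∧-reassoc (not (i =F j)) _ _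

    pureClass : PairClass
    pureClass = record
      { cls = λ i j → not (i =F j) ∧ (not (inL i) ∧ not (inL j))
      ; cls-sym = λ i j → cong₂ (λ a b → not a ∧ b) (=F-sym i j) (∧-comm (not (inL i)) (not (inL j)))
      ; cls-irrefl = λ i → cong (λ b → not b ∧ (not (inL i) ∧ not (inL i))) (=F-refl i)
      ; nL = 0
      ; nR = 2
      ; cls-labels = λ i j e → bothInR (inL i) (inL j) (proj₂ (∧-true (not (i =F j)) e))
      }
      where
      bothInR : ∀ a b → (not a ∧ not b) ≡ true → not (a ∧ b) ≡ true × ind a + ind b ≡ 0 × ind (not a) + ind (not b) ≡ 2
      bothInR false false _ = refl , refl , refl

    isPure≡ : ∀ PQ → isPure inL PQ ≡ doubleOver pureClass PQ
    isPure≡ (((i , _) , (j , _)) , Q) = ∧-reassoc (not (i =F j)) _ _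

    φL φR : Point n → ℕ
    φL p = guard (inL (vtx p)) (φ (vtx p))
    φR p = guard (not (inL (vtx p))) (φ (vtx p))

    ΣφL : Σv pts φL ≡ M₂L inL d
    ΣφL = trans (Σpts (λ i → guard (inL i) (φ i)))
      (trans (Σl-cong (allFin n) (λ i → sym (guard-* (inL i) (d i) (φ i)))) (sym (sum-map _ (allFin n))))

    ΣφR : Σv pts φR ≡ M₂R inL d
    ΣφR = trans (Σpts (λ i → guard (not (inL i)) (φ i)))
      (trans (Σl-cong (allFin n) (λ i → byLabel (inL i) {d i})) (sym (sum-map _ (allFin n))))
      where
      byLabel : ∀ b {x} → x * guard (not b) (x ∸ 1) ≡ (if b then 0 else x * (x ∸ 1))
      byLabel true {x} = *-zeroʳ x
      byLabel false = refl

    -- The mixed weight: one end in L, the other in R, so it factorises.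
    mixedWeight : ΣP pts (λ p q → ind (cls mixedClass (vtx p) (vtx q)) * (φ (vtx p) * φ (vtx q))) ≡ M₂L inL d * M₂R inL d
    mixedWeight = begin
      ΣP pts (λ p q → ind (cls mixedClass (vtx p) (vtx q)) * (φ (vtx p) * φ (vtx q)))
        ≡⟨ ΣP-cong pts split ⟩
      ΣP pts (λ p q → φL p * φR q + φR p * φL q)
        ≡⟨ sym (trans (cong (ΣP pts (λ p q → φL p * φR q + φR p * φL q) +_) (trans (Σv-cong pts notBoth) (Σv-zero pts))) (+-identityʳ _)) ⟩
      ΣP pts (λ p q → φL p * φR q + φR p * φL q) + Σv pts (λ p → φL p * φR p)
        ≡⟨ ΣP-product pts φL φR ⟩
      Σv pts φL * Σv pts φR
        ≡⟨ cong₂ _*_ ΣφL ΣφR ⟩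
      M₂L inL d * M₂R inL d ∎
      where
      open ≡-Reasoning
      split : ∀ (p q : Point n) → ind (cls mixedClass (vtx p) (vtx q)) * (φ (vtx p) * φ (vtx q)) ≡ φL p * φR q + φR p * φL q
      split (i , _) (j , _) with i =F j in e
      ... | true with =F-sound i j e
      ... | refl with inL i
      ... | true = sym (trans (+-identityʳ _) (*-zeroʳ (φ i)))
      ... | false = sym (*-zeroʳ (φ i))
      split (i , _) (j , _) | false with inL i | inL j
      ... | true | true = sym (trans (+-identityʳ _) (*-zeroʳ (φ i)))
      ... | true | false = trans (+-identityʳ _) (sym (+-identityʳ _))
      ... | false | true = +-identityʳ _
      ... | false | false = sym (*-zeroʳ (φ i))
      notBoth : ∀ p → φL p * φR p ≡ 0
      notBoth (i , _) with inL i
      ... | true = *-zeroʳ (φ i)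
      ... | false = refl

    d≤dmax : ∀ i → d i ≤ dmax inL d
    d≤dmax i = foldr-⊔-ub (map d (allFin n)) (∈-map⁺ d (∈-allFin i))
      where
      foldr-⊔-ub : ∀ (l : List ℕ) {x} → x ∈ l → x ≤ foldr _⊔_ 0 l
      foldr-⊔-ub (y ∷ l) (here refl) = m≤m⊔n y _
      foldr-⊔-ub (y ∷ l) (there m) = ≤-trans (foldr-⊔-ub l m) (m≤n⊔m y _)

    φ≤dmax : ∀ i → φ i ≤ dmax inL d
    φ≤dmax i = ≤-trans (m∸n≤m (d i) 1) (d≤dmax i)

    φR≤dmax : ∀ p → φR p ≤ dmax inL d
    φR≤dmax (i , _) with inL i
    ... | true = z≤n
    ... | false = φ≤dmax i

    M₂R≤dmax*M₁R : M₂R inL d ≤ dmax inL d * M₁R inL d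
    M₂R≤dmax*M₁R = begin
      M₂R inL d                    ≡⟨ sym ΣφR ⟩
      Σv pts φR                    ≤⟨ Σv-mono pts bound ⟩
      Σv pts (λ p → dmax inL d * iR p) ≡⟨ Σv-* pts (dmax inL d) iR ⟩
      dmax inL d * cR pts          ≡⟨ cong (dmax inL d *_) cR-pts ⟩
      dmax inL d * M₁R inL d ∎
      where
      open ≤-Reasoning
      bound : ∀ p → φR p ≤ dmax inL d * iR p
      bound (i , _) with inL i
      ... | true = z≤n
      ... | false = ≤-trans (φ≤dmax i) (≤-reflexive (sym (*-identityʳ (dmax inL d))))

    pureWeight sameVertexR : ℕ
    pureWeight = ΣP pts (λ p q → ind (cls pureClass (vtx p) (vtx q)) * (φ (vtx p) * φ (vtx q)))
    sameVertexR = ΣP pts (λ p q → ind (vtx p =F vtx q) * inR (vtx p) * (φ (vtx p) * φ (vtx q)))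

    -- M₂(R)² = (Σ φR)² splits into pairs of points at distinct R-vertices,
    -- at the same R-vertex, and the diagonal.
    pureSquare : 2 * (pureWeight + sameVertexR) + Σv pts (λ p → φR p * φR p) ≡ M₂R inL d * M₂R inL d
    pureSquare = begin
      2 * (pureWeight + sameVertexR) + Σv pts (λ p → φR p * φR p)
        ≡⟨ cong (_+ Σv pts (λ p → φR p * φR p)) offDiagonal ⟩
      ΣP pts (λ u v → φR u * φR v + φR u * φR v) + Σv pts (λ p → φR p * φR p)
        ≡⟨ ΣP-product pts φR φR ⟩
      Σv pts φR * Σv pts φR
        ≡⟨ cong₂ _*_ ΣφR ΣφR ⟩
      M₂R inL d * M₂R inL d ∎
      where
      open ≡-Reasoning
      split : ∀ (p q : Point n) → φR p * φR q ≡
        ind (cls pureClass (vtx p) (vtx q)) * (φ (vtx p) * φ (vtx q)) + ind (vtx p =F vtx q) * inR (vtx p) * (φ (vtx p) * φ (vtx q))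
      split (i , _) (j , _) with i =F j in e
      ... | true with =F-sound i j e
      ... | refl with inL i
      ... | true = refl
      ... | false = sym (+-identityʳ _)
      split (i , _) (j , _) | false with inL i | inL j
      ... | true | true = refl
      ... | true | false = refl
      ... | false | true = *-zeroʳ (φ i)
      ... | false | false = sym (trans (+-identityʳ _) (+-identityʳ _))
      double : ∀ a → a + a ≡ 2 * a
      double = solve-∀
      offDiagonal : 2 * (pureWeight + sameVertexR) ≡ ΣP pts (λ u v → φR u * φR v + φR u * φR v)
      offDiagonal = sym (trans (ΣP-+ pts (λ u v → φR u * φR v) (λ u v → φR u * φR v))
        (trans (cong (λ z → z + z) (trans (ΣP-cong pts split) (ΣP-+ pts _ _))) (double (pureWeight + sameVertexR))))

    -- Pairs at a common R-vertex weigh at most dmax² per loop position.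
    sameVertexR≤ : 2 * sameVertexR ≤ dmax inL d * dmax inL d * M₂R inL d
    sameVertexR≤ = begin
      2 * sameVertexR
        ≤⟨ *-monoʳ-≤ 2 (ΣP-mono pts bound) ⟩
      2 * ΣP pts (λ u v → D * (ind (vtx u =F vtx v) * inR (vtx u)))
        ≡⟨ cong (2 *_) (ΣP-* pts D _) ⟩
      2 * (D * loopWeight)
        ≡⟨ trans (swap D loopWeight) (cong (D *_) loopWeight-M₂R) ⟩
      D * M₂R inL d ∎
      where
      open ≤-Reasoning
      D : ℕ
      D = dmax inL d * dmax inL d
      bound : ∀ (u v : Point n) → ind (vtx u =F vtx v) * inR (vtx u) * (φ (vtx u) * φ (vtx v)) ≤ D * (ind (vtx u =F vtx v) * inR (vtx u))
      bound u v = ≤-trans (≤-reflexive (*-comm (ind (vtx u =F vtx v) * inR (vtx u)) _))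
                          (*-monoˡ-≤ (ind (vtx u =F vtx v) * inR (vtx u)) (*-mono-≤ (φ≤dmax (vtx u)) (φ≤dmax (vtx v))))
      swap : ∀ a b → 2 * (a * b) ≡ a * (2 * b)
      swap = solve-∀

    diagonalR≤ : Σv pts (λ p → φR p * φR p) ≤ dmax inL d * M₂R inL d
    diagonalR≤ = ≤-trans (Σv-mono pts (λ p → *-monoˡ-≤ (φR p) (φR≤dmax p)))
                         (≤-reflexive (trans (Σv-* pts (dmax inL d) φR) (cong (dmax inL d *_) ΣφR)))

    pureWeight-upper : 2 * pureWeight ≤ M₂R inL d * M₂R inL d
    pureWeight-upper = ≤-trans (≤-trans (*-monoʳ-≤ 2 (m≤m+n pureWeight sameVertexR)) (m≤m+n _ _)) (≤-reflexive pureSquare)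

    pureWeight-lower : M₂R inL d * M₂R inL d ≤ 2 * pureWeight + (dmax inL d * dmax inL d + dmax inL d) * M₂R inL d
    pureWeight-lower = begin
      M₂R inL d * M₂R inL d
        ≡⟨ sym pureSquare ⟩
      2 * (pureWeight + sameVertexR) + Σv pts (λ p → φR p * φR p)
        ≤⟨ +-mono-≤ (≤-reflexive (*-distribˡ-+ 2 pureWeight sameVertexR)) diagonalR≤ ⟩
      2 * pureWeight + 2 * sameVertexR + dmax inL d * M₂R inL d
        ≤⟨ +-monoˡ-≤ _ (+-monoʳ-≤ (2 * pureWeight) sameVertexR≤) ⟩
      2 * pureWeight + dmax inL d * dmax inL d * M₂R inL d + dmax inL d * M₂R inL d
        ≡⟨ regroup (2 * pureWeight) (dmax inL d) (M₂R inL d) ⟩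
      2 * pureWeight + (dmax inL d * dmax inL d + dmax inL d) * M₂R inL d ∎
      where
      open ≤-Reasoning
      regroup : ∀ w m r → w + m * m * r + m * r ≡ w + (m * m + m) * r
      regroup = solve-∀

    sumB₀ : sum (map (B₀ inL) RP) ≡ loopWeight * rpm (M₁L inL d) (M₁R inL d ∸ 2)
    sumB₀ = trans (Σ-restricted (B₀ inL)) (trans ΣB₀ (cong₂ (λ u v → loopWeight * rpm u (v ∸ 2)) cL-pts cR-pts))

    sumB₁ : 2 * sum (map (B₁ inL) RP) ≡ M₂L inL d * M₂R inL d * rpm (M₁L inL d ∸ 2) (M₁R inL d ∸ 2)
    sumB₁ =
      trans (cong (2 *_) (Σ-restricted (B₁ inL)))
      (trans (ΣR-doubles mixedClass (isMixed inL) isMixed≡)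
             (cong₂ _*_ (trans (doubleCount mixedClass (isMixed inL) isMixed≡) mixedWeight)
                        (cong₂ (λ u v → rpm (u ∸ 2) (v ∸ 2)) cL-pts cR-pts)))

    sumB₂ : 2 * sum (map (B₂ inL) RP) ≡ pureWeight * rpm (M₁L inL d) (M₁R inL d ∸ 4)
    sumB₂ =
      trans (cong (2 *_) (Σ-restricted (B₂ inL)))
      (trans (ΣR-doubles pureClass (isPure inL) isPure≡)
             (cong₂ _*_ (doubleCount pureClass (isPure inL) isPure≡)
                        (cong₂ (λ u v → rpm u (v ∸ 4)) cL-pts cR-pts)))

    M-split : M inL d ≡ M₁L inL d + M₁R inL d
    M-split = trans (sum-map d (allFin n)) (trans (Σl-cong (allFin n) byLabel)
       (trans (Σl-+ (allFin n) _ _) (sym (cong₂ _+_ (sum-map _ (allFin n)) (sum-map _ (allFin n))))))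
      where
      byLabel : ∀ i → d i ≡ (if inL i then d i else 0) + (if inL i then 0 else d i)
      byLabel i with inL i
      ... | true = sym (+-identityʳ (d i))
      ... | false = refl

    -- With at most one point in L there is no pair of points inside L.
    M₂L-vanishes : M₁L inL d ≤ 1 → M₂L inL d ≡ 0
    M₂L-vanishes h = trans (sum-map _ (allFin n)) (trans (Σl-cong (allFin n) atVertex) (Σl-zero (allFin n)))
      where
      atMostOne : ∀ x → x ≤ 1 → x * (x ∸ 1) ≡ 0
      atMostOne zero _ = refl
      atMostOne (suc zero) _ = refl
      atMostOne (suc (suc x)) (s≤s ())
      atVertex : ∀ i → (if inL i then d i * (d i ∸ 1) else 0) ≡ 0
      atVertex i with inL i in e
      ... | false = refl
      ... | true = atMostOne (d i) (≤-trans (≤-trans (≤-reflexive (sym (cong (λ b → if b then d i else 0) e)))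
                                                     (Σl-≥ (allFin n) (λ j → if inL j then d j else 0) (∈-allFin i)))
                                            (≤-trans (≤-reflexive (sym (sum-map _ (allFin n)))) h))

module RationalBounds where

  open import Data.Nat as ℕ using (ℕ; zero; suc)
  import Data.Nat.Properties as NP
  open import Data.Integer as ℤ using (+_)
  import Data.Integer.Properties as ℤP
  open import Data.Rational using (ℚ; 0ℚ; _≤_; _<_; _+_; _*_; _-_; ∣_∣; -_; toℚᵘ; NonNegative; mkℚ)
  import Data.Rational as Q
  import Data.Rational.Properties as QP
  import Data.Rational.Unnormalised as U
  import Data.Rational.Unnormalised.Properties as UP
  open import Data.Product using (_,_; ∃)
  open import Data.Sum using (inj₁; inj₂)
  open import Relation.Binary.PropositionalEquality
  open import Data.Nat.Tactic.RingSolver using (solve-∀)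
  open import Data.Rational.Solver using (module +-*-Solver)
  open +-*-Solver using (solve; _:=_; _:+_; _:-_; :-_)

  -- Quotients of naturals are compared, multiplied and added by cross
  -- multiplication; everything rational below reduces to inequalities in ℕ.
  private
    toℚᵘ-ratio : ∀ X N → toℚᵘ (ratio X (suc N)) U.≃ U.mkℚᵘ (+ X) N
    toℚᵘ-ratio X N = QP.toℚᵘ-fromℚᵘ (U.mkℚᵘ (+ X) N)

  ratio-≤ : ∀ X N Y M → X ℕ.* suc M ℕ.≤ Y ℕ.* suc N → ratio X (suc N) ≤ ratio Y (suc M)
  ratio-≤ X N Y M h = QP.toℚᵘ-cancel-≤ (UP.≤-respˡ-≃ (UP.≃-sym (toℚᵘ-ratio X N)) (UP.≤-respʳ-≃ (UP.≃-sym (toℚᵘ-ratio Y M))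
    (U.*≤* (subst₂ ℤ._≤_ (ℤP.pos-* X (suc M)) (ℤP.pos-* Y (suc N)) (ℤ.+≤+ h)))))

  ratio-≤⁻ : ∀ X N Y M → ratio X (suc N) ≤ ratio Y (suc M) → X ℕ.* suc M ℕ.≤ Y ℕ.* suc N
  ratio-≤⁻ X N Y M h with UP.≤-respˡ-≃ (toℚᵘ-ratio X N) (UP.≤-respʳ-≃ (toℚᵘ-ratio Y M) (QP.toℚᵘ-mono-≤ h))
  ... | U.*≤* h' = ℤP.drop‿+≤+ (subst₂ ℤ._≤_ (sym (ℤP.pos-* X (suc M))) (sym (ℤP.pos-* Y (suc N))) h')

  ratio-* : ∀ X N Y M → ratio X (suc N) * ratio Y (suc M) ≡ ratio (X ℕ.* Y) (suc N ℕ.* suc M)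
  ratio-* X N Y M = QP.toℚᵘ-injective (UP.≃-trans (QP.toℚᵘ-homo-* (ratio X (suc N)) (ratio Y (suc M)))
    (UP.≃-trans (UP.*-cong (toℚᵘ-ratio X N) (toℚᵘ-ratio Y M))
     (UP.≃-trans (U.*≡* (cong (ℤ._* (+ (suc N ℕ.* suc M))) (sym (ℤP.pos-* X Y))))
                 (UP.≃-sym (toℚᵘ-ratio (X ℕ.* Y) (M ℕ.+ N ℕ.* suc M))))))

  ratio-*-pos : ∀ X N Y M → 0 ℕ.< N → 0 ℕ.< M → ratio X N * ratio Y M ≡ ratio (X ℕ.* Y) (N ℕ.* M)
  ratio-*-pos X (suc N) Y (suc M) _ _ = ratio-* X N Y M

  ratio-+ : ∀ X N Y M → ratio X (suc N) + ratio Y (suc M) ≡ ratio (X ℕ.* suc M ℕ.+ Y ℕ.* suc N) (suc N ℕ.* suc M)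
  ratio-+ X N Y M = QP.toℚᵘ-injective (UP.≃-trans (QP.toℚᵘ-homo-+ (ratio X (suc N)) (ratio Y (suc M)))
    (UP.≃-trans (UP.+-cong (toℚᵘ-ratio X N) (toℚᵘ-ratio Y M))
     (UP.≃-trans (U.*≡* (cong (ℤ._* (+ (suc N ℕ.* suc M))) numerator))
                 (UP.≃-sym (toℚᵘ-ratio (X ℕ.* suc M ℕ.+ Y ℕ.* suc N) (M ℕ.+ N ℕ.* suc M))))))
    where
    numerator : + X ℤ.* + suc M ℤ.+ + Y ℤ.* + suc N ≡ + (X ℕ.* suc M ℕ.+ Y ℕ.* suc N)
    numerator = trans (cong₂ ℤ._+_ (sym (ℤP.pos-* X (suc M))) (sym (ℤP.pos-* Y (suc N))))
                      (sym (ℤP.pos-+ (X ℕ.* suc M) (Y ℕ.* suc N)))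

  ratio-nonNeg : ∀ X N → NonNegative (ratio X N)
  ratio-nonNeg X zero = _
  ratio-nonNeg X (suc N) = QP.normalize-nonNeg X (suc N)

  unitFraction-pos : ∀ k → 0ℚ < ratio 1 (suc k)
  unitFraction-pos k = QP.positive⁻¹ (ratio 1 (suc k)) {{QP.normalize-pos 1 (suc k)}}

  unitFraction-below : ∀ ε → 0ℚ < ε → ∃ λ k → ratio 1 (suc k) ≤ ε
  unitFraction-below (mkℚ (+ 0) d c) (Q.*<* (ℤ.+<+ ()))
  unitFraction-below (mkℚ (+ suc p) d c) _ = d , subst (ratio 1 (suc d) ≤_) (QP.↥p/↧p≡p (mkℚ (+ suc p) d c))
    (ratio-≤ 1 d (suc p) d (NP.*-monoˡ-≤ (suc d) {1} {suc p} (ℕ.s≤s ℕ.z≤n)))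
  unitFraction-below (mkℚ ℤ.-[1+ n ] d c) (Q.*<* ())

  below-unitFraction : ∀ x M k → ℕtoℚ x ≤ ratio 1 (suc k) * ℕtoℚ M → x ℕ.* suc k ℕ.≤ M
  below-unitFraction x M k h =
    subst₂ ℕ._≤_ (cong (x ℕ.*_) (cong suc (NP.*-identityʳ k))) (trans (NP.*-identityʳ (1 ℕ.* M)) (NP.*-identityˡ M))
      (ratio-≤⁻ x 0 (1 ℕ.* M) (0 ℕ.+ k ℕ.* 1) (subst (ℕtoℚ x ≤_) (ratio-* 1 k M 0) h))

  ∣-∣≤ : ∀ p q r → p ≤ q + r → q ≤ p + r → ∣ p - q ∣ ≤ r
  ∣-∣≤ p q r h₁ h₂ with QP.∣p∣≡p∨∣p∣≡-p (p - q)
  ... | inj₁ e = subst (_≤ r) (sym e) (QP.≤-trans (QP.+-monoˡ-≤ (- q) h₁) (QP.≤-reflexive (cancel p q r)))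
    where
    cancel : ∀ p q r → q + r - q ≡ r
    cancel = solve 3 (λ p q r → q :+ r :- q := r) refl
  ... | inj₂ e = subst (_≤ r) (sym e) (QP.≤-trans (QP.≤-reflexive (negate p q r))
                                       (QP.≤-trans (QP.+-monoˡ-≤ (- p) h₂) (QP.≤-reflexive (cancel p q r))))
    where
    negate : ∀ p q r → - (p - q) ≡ q - p
    negate = solve 3 (λ p q r → :- (p :- q) := q :- p) refl
    cancel : ∀ p q r → p + r - p ≡ r
    cancel = solve 3 (λ p q r → p :+ r :- p := r) refl

  bigO-criterion : ∀ X N U V C → 0 ℕ.< N → 0 ℕ.< V →
    X ℕ.* V ℕ.≤ C ℕ.* U ℕ.* N → ratio X N ≤ ℕtoℚ C * ratio U V
  bigO-criterion X (suc n') U (suc v') C _ _ h = subst (ratio X (suc n') ≤_) (sym (ratio-* C 0 U v'))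
    (ratio-≤ X n' (C ℕ.* U) (v' ℕ.+ 0) (subst (λ z → X ℕ.* suc z ℕ.≤ C ℕ.* U ℕ.* suc n') (sym (NP.+-identityʳ v')) h))

  relative-criterion : ∀ X N U V k → 0 ℕ.< N → 0 ℕ.< V →
    X ℕ.* V ℕ.* suc k ℕ.≤ U ℕ.* N ℕ.* suc k ℕ.+ U ℕ.* N →
    U ℕ.* N ℕ.* suc k ℕ.≤ X ℕ.* V ℕ.* suc k ℕ.+ U ℕ.* N →
    ∀ ε → ratio 1 (suc k) ≤ ε → ∣ ratio X N - ratio U V ∣ ≤ ε * ratio U V
  relative-criterion X (suc n') U (suc v') k _ _ h₁ h₂ ε hε =
    QP.≤-trans (∣-∣≤ (ratio X N) (ratio U V) (ratio 1 K * ratio U V) upper lower)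
               (QP.*-monoʳ-≤-nonNeg (ratio U V) {{ratio-nonNeg U V}} hε)
    where
    N : ℕ
    N = suc n'
    V : ℕ
    V = suc v'
    K : ℕ
    K = suc k
    Mk : ℕ
    Mk = v' ℕ.+ k ℕ.* V
    eqA : ∀ X V K → X ℕ.* V ℕ.* K ℕ.* V ≡ X ℕ.* (V ℕ.* (K ℕ.* V))
    eqA = solve-∀
    eqB : ∀ U N K V → (U ℕ.* N ℕ.* K ℕ.+ U ℕ.* N) ℕ.* V ≡ (U ℕ.* (K ℕ.* V) ℕ.+ 1 ℕ.* U ℕ.* V) ℕ.* N
    eqB = solve-∀
    eqC : ∀ U N K V → U ℕ.* N ℕ.* K ℕ.* V ≡ U ℕ.* (N ℕ.* (K ℕ.* V))
    eqC = solve-∀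
    eqD : ∀ X V K U N → (X ℕ.* V ℕ.* K ℕ.+ U ℕ.* N) ℕ.* V ≡ (X ℕ.* (K ℕ.* V) ℕ.+ 1 ℕ.* U ℕ.* N) ℕ.* V
    eqD = solve-∀
    upper : ratio X N ≤ ratio U V + ratio 1 K * ratio U V
    upper = subst (ratio X N ≤_) (sym (trans (cong (λ z → ratio U V + z) (ratio-* 1 k U v')) (ratio-+ U v' (1 ℕ.* U) Mk)))
      (ratio-≤ X n' (U ℕ.* suc Mk ℕ.+ 1 ℕ.* U ℕ.* V) (Mk ℕ.+ v' ℕ.* suc Mk)
               (subst₂ ℕ._≤_ (eqA X V K) (eqB U N K V) (NP.*-monoˡ-≤ V h₁)))
    lower : ratio U V ≤ ratio X N + ratio 1 K * ratio U V
    lower = subst (ratio U V ≤_) (sym (trans (cong (λ z → ratio X N + z) (ratio-* 1 k U v')) (ratio-+ X n' (1 ℕ.* U) Mk)))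
      (ratio-≤ U v' (X ℕ.* suc Mk ℕ.+ 1 ℕ.* U ℕ.* N) (Mk ℕ.+ n' ℕ.* suc Mk)
               (subst₂ ℕ._≤_ (eqC U N K V) (eqD X V K U N) (NP.*-monoˡ-≤ V h₂)))

  relativePlusAbsolute-criterion : ∀ X N U V k → 0 ℕ.< N → 0 ℕ.< V →
    X ℕ.* V ℕ.* suc k ℕ.≤ U ℕ.* N ℕ.* suc k ℕ.+ U ℕ.* N ℕ.+ N ℕ.* V →
    U ℕ.* N ℕ.* suc k ℕ.≤ X ℕ.* V ℕ.* suc k ℕ.+ U ℕ.* N ℕ.+ N ℕ.* V →
    ∀ ε → ratio 1 (suc k) ≤ ε → ∣ ratio X N - ratio U V ∣ ≤ ε * ratio U V + ε
  relativePlusAbsolute-criterion X (suc n') U (suc v') k _ _ h₁ h₂ ε hε =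
    QP.≤-trans (∣-∣≤ (ratio X N) (ratio U V) r upper lower)
               (QP.+-mono-≤ (QP.*-monoʳ-≤-nonNeg (ratio U V) {{ratio-nonNeg U V}} hε) hε)
    where
    N : ℕ
    N = suc n'
    V : ℕ
    V = suc v'
    K : ℕ
    K = suc k
    Mk : ℕ
    Mk = v' ℕ.+ k ℕ.* V
    R₁ : ℕ
    R₁ = 1 ℕ.* U ℕ.* K ℕ.+ 1 ℕ.* suc Mk
    M₁ : ℕ
    M₁ = k ℕ.+ Mk ℕ.* K
    r : ℚ
    r = ratio 1 K * ratio U V + ratio 1 K
    r≡ : r ≡ ratio R₁ (suc M₁)
    r≡ = trans (cong (λ z → z + ratio 1 K) (ratio-* 1 k U v')) (ratio-+ (1 ℕ.* U) Mk 1 k)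
    eqA : ∀ X V K → X ℕ.* V ℕ.* K ℕ.* (V ℕ.* K) ≡ X ℕ.* (V ℕ.* (K ℕ.* V ℕ.* K))
    eqA = solve-∀
    eqB : ∀ U N K V → (U ℕ.* N ℕ.* K ℕ.+ U ℕ.* N ℕ.+ N ℕ.* V) ℕ.* (V ℕ.* K) ≡
      (U ℕ.* (K ℕ.* V ℕ.* K) ℕ.+ (1 ℕ.* U ℕ.* K ℕ.+ 1 ℕ.* (K ℕ.* V)) ℕ.* V) ℕ.* N
    eqB = solve-∀
    eqC : ∀ U N K V → U ℕ.* N ℕ.* K ℕ.* (V ℕ.* K) ≡ U ℕ.* (N ℕ.* (K ℕ.* V ℕ.* K))
    eqC = solve-∀
    eqD : ∀ X V K U N → (X ℕ.* V ℕ.* K ℕ.+ U ℕ.* N ℕ.+ N ℕ.* V) ℕ.* (V ℕ.* K) ≡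
      (X ℕ.* (K ℕ.* V ℕ.* K) ℕ.+ (1 ℕ.* U ℕ.* K ℕ.+ 1 ℕ.* (K ℕ.* V)) ℕ.* N) ℕ.* V
    eqD = solve-∀
    upper : ratio X N ≤ ratio U V + r
    upper = subst (ratio X N ≤_) (sym (trans (cong (λ z → ratio U V + z) r≡) (ratio-+ U v' R₁ M₁)))
      (ratio-≤ X n' (U ℕ.* suc M₁ ℕ.+ R₁ ℕ.* V) (M₁ ℕ.+ v' ℕ.* suc M₁)
               (subst₂ ℕ._≤_ (eqA X V K) (eqB U N K V) (NP.*-monoˡ-≤ (V ℕ.* K) h₁)))
    lower : ratio U V ≤ ratio X N + r
    lower = subst (ratio U V ≤_) (sym (trans (cong (λ z → ratio X N + z) r≡) (ratio-+ X n' R₁ M₁)))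
      (ratio-≤ U v' (X ℕ.* suc M₁ ℕ.+ R₁ ℕ.* N) (M₁ ℕ.+ n' ℕ.* suc M₁)
               (subst₂ ℕ._≤_ (eqC U N K V) (eqD X V K U N) (NP.*-monoˡ-≤ (V ℕ.* K) h₂)))

module NatBounds where

  open import Data.Nat using (ℕ; zero; suc; _+_; _*_; _∸_; _≤_; z≤n; s≤s; NonZero)
  open import Data.Nat.Properties
  open import Data.Product using (_×_; _,_)
  open import Data.List using (_∷_; [])
  open import Relation.Binary.PropositionalEquality
  open import Data.Nat.Tactic.RingSolver using (solve-∀; solve)
  open ≤-Reasoning

  -- Two quotients X/N and U/V in proportion (c+1) : c, written cross-multiplied
  -- through a common W: the first is at most twice the second once c ≥ 1, and
  -- their difference is at most a (1/K)-fraction of the second once K ≤ c.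
  proportional-bounds : ∀ X V U N W c K → X * V ≡ W * suc c → U * N ≡ W * c →
     (1 ≤ c → X * V ≤ 2 * U * N) × (K ≤ c → X * V * K ≤ U * N * K + U * N) × (U * N * K ≤ X * V * K + U * N)
  proportional-bounds X V U N W c K e₁ e₂ = twice , above , below
    where
    twice : 1 ≤ c → X * V ≤ 2 * U * N
    twice h = begin
      X * V             ≡⟨ e₁ ⟩
      W * suc c         ≤⟨ *-monoʳ-≤ W (+-monoˡ-≤ c h) ⟩
      W * (c + c)       ≡⟨ solve (W ∷ c ∷ []) ⟩
      2 * (W * c)       ≡⟨ cong (2 *_) (sym e₂) ⟩
      2 * (U * N)       ≡⟨ sym (*-assoc 2 U N) ⟩
      2 * U * N ∎
    above : K ≤ c → X * V * K ≤ U * N * K + U * N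
    above h = begin
      X * V * K                 ≡⟨ cong (_* K) e₁ ⟩
      W * suc c * K             ≡⟨ solve (W ∷ c ∷ K ∷ []) ⟩
      W * c * K + W * K         ≤⟨ +-monoʳ-≤ (W * c * K) (*-monoʳ-≤ W h) ⟩
      W * c * K + W * c         ≡⟨ cong (λ z → z * K + z) (sym e₂) ⟩
      U * N * K + U * N ∎
    below : U * N * K ≤ X * V * K + U * N
    below = begin
      U * N * K          ≡⟨ cong (_* K) e₂ ⟩
      W * c * K          ≤⟨ *-monoˡ-≤ K (*-monoʳ-≤ W (n≤1+n c)) ⟩
      W * suc c * K      ≡⟨ cong (_* K) (sym e₁) ⟩
      X * V * K          ≤⟨ m≤m+n _ _ ⟩
      X * V * K + U * N ∎

  -- B4 c = (3+c)(2+c)(1+c)c is b(b-1)(b-2)(b-3) for b = 3 + c; it is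
  -- comparable to b⁴, and asymptotically equal to it.
  B4 : ℕ → ℕ
  B4 c = (3 + c) * (2 + c) * (1 + c) * c

  c⁴≤B4 : ∀ c → c * c * c * c ≤ B4 c
  c⁴≤B4 c = *-monoˡ-≤ c (*-mono-≤ (*-mono-≤ (m≤n+m c 3) (m≤n+m c 2)) (m≤n+m c 1))

  B4≤b⁴ : ∀ c → B4 c ≤ (3 + c) * (3 + c) * (3 + c) * (3 + c)
  B4≤b⁴ c = *-mono-≤ (*-mono-≤ (*-monoʳ-≤ (3 + c) (n≤1+n (2 + c))) (≤-trans (n≤1+n (1 + c)) (n≤1+n (2 + c)))) (m≤n+m c 3)

  b⁴≤16B4 : ∀ c → 3 ≤ c → (3 + c) * (3 + c) * (3 + c) * (3 + c) ≤ 16 * B4 c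
  b⁴≤16B4 c h = begin
    (3 + c) * (3 + c) * (3 + c) * (3 + c) ≤⟨ *-mono-≤ (*-mono-≤ (*-mono-≤ 3+c≤2c 3+c≤2c) 3+c≤2c) 3+c≤2c ⟩
    (c + c) * (c + c) * (c + c) * (c + c) ≡⟨ solve (c ∷ []) ⟩
    16 * (c * c * c * c)                  ≤⟨ *-monoʳ-≤ 16 (c⁴≤B4 c) ⟩
    16 * B4 c ∎
    where
    3+c≤2c : 3 + c ≤ c + c
    3+c≤2c = ≤-trans (≤-reflexive (+-comm 3 c)) (+-monoʳ-≤ c h)

  b⁴≈B4 : ∀ c K → 255 * K + 1 ≤ c → (3 + c) * (3 + c) * (3 + c) * (3 + c) * K ≤ B4 c * (K + 1)
  b⁴≈B4 c K h = begin
    (3 + c) * (3 + c) * (3 + c) * (3 + c) * K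
      ≡⟨ solve (c ∷ K ∷ []) ⟩
    c * c * c * c * K + (12 * (c * c * c) + 54 * (c * c) + 108 * c + 81) * K
      ≤⟨ +-monoʳ-≤ (c * c * c * c * K) (*-monoˡ-≤ K lowerOrder) ⟩
    c * c * c * c * K + 255 * (c * c * c) * K
      ≡⟨ solve (c ∷ K ∷ []) ⟩
    c * c * c * c * K + c * c * c * (255 * K)
      ≤⟨ +-monoʳ-≤ (c * c * c * c * K) (*-monoʳ-≤ (c * c * c) (≤-trans (m≤m+n (255 * K) 1) h)) ⟩
    c * c * c * c * K + c * c * c * c
      ≡⟨ solve (c ∷ K ∷ []) ⟩
    c * c * c * c * (K + 1)
      ≤⟨ *-monoˡ-≤ (K + 1) (c⁴≤B4 c) ⟩
    B4 c * (K + 1) ∎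
    where
    1≤c : 1 ≤ c
    1≤c = ≤-trans (m≤n+m 1 (255 * K)) h
    c²≤c³ : c * c ≤ c * c * c
    c²≤c³ = ≤-trans (≤-reflexive (sym (*-identityʳ (c * c)))) (*-monoʳ-≤ (c * c) 1≤c)
    c≤c³ : c ≤ c * c * c
    c≤c³ = ≤-trans (≤-trans (≤-reflexive (sym (*-identityʳ c))) (*-monoʳ-≤ c 1≤c)) c²≤c³
    lowerOrder : 12 * (c * c * c) + 54 * (c * c) + 108 * c + 81 ≤ 255 * (c * c * c)
    lowerOrder = begin
      12 * (c * c * c) + 54 * (c * c) + 108 * c + 81
        ≤⟨ +-mono-≤ (+-mono-≤ (+-monoʳ-≤ (12 * (c * c * c)) (*-monoʳ-≤ 54 c²≤c³)) (*-monoʳ-≤ 108 c≤c³))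
                    (*-monoʳ-≤ 81 (≤-trans 1≤c c≤c³)) ⟩
      12 * (c * c * c) + 54 * (c * c * c) + 108 * (c * c * c) + 81 * (c * c * c)
        ≡⟨ solve (c ∷ []) ⟩
      255 * (c * c * c) ∎

  s²≤s[s-2]+2s : ∀ s → s * s ≤ s * (s ∸ 2) + 2 * s
  s²≤s[s-2]+2s zero = z≤n
  s²≤s[s-2]+2s (suc zero) = s≤s z≤n
  s²≤s[s-2]+2s (suc (suc t)) = ≤-reflexive (expand t)
    where
    expand : ∀ t → suc (suc t) * suc (suc t) ≡ suc (suc t) * t + 2 * suc (suc t)
    expand = solve-∀

  -- The absolute error term of the pure estimate: s²(dmax² + dmax)R K ≤ 4b⁴
  -- when s ≤ b, R ≤ dmax·b and dmax³ K ≤ 2b.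
  smallDegree-bound : ∀ s b R dm K → s ≤ b → R ≤ dm * b → dm * dm * dm * K ≤ 2 * b →
    s * s * ((dm * dm + dm) * R) * K ≤ 4 * (b * b * b * b)
  smallDegree-bound s b R dm K hs hR hd = begin
    s * s * ((dm * dm + dm) * R) * K
      ≤⟨ *-monoˡ-≤ K (*-mono-≤ (*-mono-≤ hs hs) (*-mono-≤ (+-monoʳ-≤ (dm * dm) (m≤m*m dm)) hR)) ⟩
    b * b * ((dm * dm + dm * dm) * (dm * b)) * K ≡⟨ solve (b ∷ dm ∷ K ∷ []) ⟩
    2 * (b * b * b) * (dm * dm * dm * K)          ≤⟨ *-monoʳ-≤ (2 * (b * b * b)) hd ⟩
    2 * (b * b * b) * (2 * b)                     ≡⟨ solve (b ∷ []) ⟩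
    4 * (b * b * b * b) ∎
    where
    m≤m*m : ∀ x → x ≤ x * x
    m≤m*m zero = z≤n
    m≤m*m (suc x) = m≤m*n (suc x) (suc x)

  -- With X the sum of B₂, N the number of
  -- pairings, 2X = P g₄, s s₂ N = B g₄ (s = b - a, s₂ = s - 2, B = b(b-1)(b-2)(b-3)),
  -- P within Y of R²/2 and V = 4b⁴, the quotient X/N is compared with (sR)²/V.
  module PureArithmetic (X N P g₄ s s₂ R B b Y V : ℕ) .{{_ : NonZero B}}
    (twiceX : 2 * X ≡ P * g₄) (fourFold : s * s₂ * N ≡ B * g₄)
    (P-upper : 2 * P ≤ R * R) (P-lower : R * R ≤ 2 * P + Y)
    (s-square : s * s ≤ s * s₂ + 2 * s) (s₂≤s : s₂ ≤ s) (B≤b⁴ : B ≤ b * b * b * b) (V≡ : V ≡ 4 * (b * b * b * b)) where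

    base : 2 * B * (X * V) ≡ P * (s * s₂ * N) * V
    base = begin-equality
      2 * B * (X * V) ≡⟨ solve (X ∷ V ∷ B ∷ []) ⟩
      2 * X * B * V   ≡⟨ cong (λ z → z * B * V) twiceX ⟩
      P * g₄ * B * V  ≡⟨ solve (P ∷ g₄ ∷ B ∷ V ∷ []) ⟩
      P * (B * g₄) * V ≡⟨ cong (λ z → P * z * V) (sym fourFold) ⟩
      P * (s * s₂ * N) * V ∎

    private
      instance
        2B≢0 : NonZero (2 * B)
        2B≢0 = m*n≢0 2 B

    pure-bigO : b * b * b * b ≤ 16 * B → X * V ≤ 32 * (s * R * (s * R)) * N
    pure-bigO h = *-cancelˡ-≤ (2 * B) (begin
      2 * B * (X * V)                        ≡⟨ base ⟩
      P * (s * s₂ * N) * V                   ≤⟨ *-monoˡ-≤ V (*-mono-≤ (m≤n+m P P) (*-monoˡ-≤ N (*-monoʳ-≤ s s₂≤s))) ⟩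
      (P + P) * (s * s * N) * V              ≡⟨ cong (λ z → (P + z) * (s * s * N) * V) (sym (+-identityʳ P)) ⟩
      2 * P * (s * s * N) * V                ≤⟨ *-monoˡ-≤ V (*-monoˡ-≤ (s * s * N) P-upper) ⟩
      R * R * (s * s * N) * V                ≡⟨ cong (R * R * (s * s * N) *_) V≡ ⟩
      R * R * (s * s * N) * (4 * (b * b * b * b)) ≤⟨ *-monoʳ-≤ (R * R * (s * s * N)) (*-monoʳ-≤ 4 h) ⟩
      R * R * (s * s * N) * (4 * (16 * B))   ≡⟨ solve (R ∷ s ∷ N ∷ B ∷ []) ⟩
      2 * B * (32 * (s * R * (s * R)) * N) ∎)

    pure-above : ∀ K → b * b * b * b * K ≤ B * (K + 1) →
      X * V * K ≤ s * R * (s * R) * N * K + s * R * (s * R) * N + N * V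
    pure-above K h = *-cancelˡ-≤ (2 * B) (begin
      2 * B * (X * V * K)
        ≡⟨ trans (sym (*-assoc (2 * B) (X * V) K)) (cong (_* K) base) ⟩
      P * (s * s₂ * N) * V * K
        ≤⟨ *-monoˡ-≤ K (*-monoˡ-≤ V (*-monoʳ-≤ P (*-monoˡ-≤ N (*-monoʳ-≤ s s₂≤s)))) ⟩
      P * (s * s * N) * V * K
        ≡⟨ cong (λ z → P * (s * s * N) * z * K) V≡ ⟩
      P * (s * s * N) * (4 * (b * b * b * b)) * K
        ≡⟨ solve (P ∷ s ∷ N ∷ b ∷ K ∷ []) ⟩
      P * (s * s * N) * 4 * (b * b * b * b * K)
        ≤⟨ *-monoʳ-≤ (P * (s * s * N) * 4) h ⟩
      P * (s * s * N) * 4 * (B * (K + 1))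
        ≡⟨ solve (P ∷ s ∷ N ∷ B ∷ K ∷ []) ⟩
      2 * P * (2 * B * (s * s * N * (K + 1)))
        ≤⟨ *-monoˡ-≤ (2 * B * (s * s * N * (K + 1))) P-upper ⟩
      R * R * (2 * B * (s * s * N * (K + 1)))
        ≡⟨ solve (R ∷ B ∷ s ∷ N ∷ K ∷ []) ⟩
      2 * B * (s * R * (s * R) * N * K + s * R * (s * R) * N)
        ≤⟨ *-monoʳ-≤ (2 * B) (m≤m+n (s * R * (s * R) * N * K + s * R * (s * R) * N) (N * V)) ⟩
      2 * B * (s * R * (s * R) * N * K + s * R * (s * R) * N + N * V) ∎)

    pure-below : ∀ K → 2 * K ≤ s → s * s * Y * K ≤ V →
      s * R * (s * R) * N * K ≤ X * V * K + s * R * (s * R) * N + N * V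
    pure-below K h₁ h₂ = *-cancelˡ-≤ (2 * B) (begin
      2 * B * (s * R * (s * R) * N * K)
        ≡⟨ solve (B ∷ s ∷ R ∷ N ∷ K ∷ []) ⟩
      2 * B * (s * s) * (R * R) * N * K
        ≤⟨ *-monoˡ-≤ K (*-monoˡ-≤ N (*-monoˡ-≤ (R * R) (*-monoʳ-≤ (2 * B) s-square))) ⟩
      2 * B * (s * s₂ + 2 * s) * (R * R) * N * K
        ≡⟨ solve (B ∷ s ∷ s₂ ∷ R ∷ N ∷ K ∷ []) ⟩
      2 * B * (s * s₂) * (R * R) * N * K + 2 * B * (2 * K * s * (R * R) * N)
        ≤⟨ +-monoˡ-≤ _ (*-monoˡ-≤ K (*-monoˡ-≤ N (*-monoʳ-≤ (2 * B * (s * s₂)) P-lower))) ⟩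
      2 * B * (s * s₂) * (2 * P + Y) * N * K + 2 * B * (2 * K * s * (R * R) * N)
        ≡⟨ solve (B ∷ s ∷ s₂ ∷ P ∷ Y ∷ N ∷ K ∷ R ∷ []) ⟩
      P * (s * s₂ * N) * (4 * B) * K + (2 * B * (s * s₂ * Y * K) * N + 2 * B * (2 * K * s * (R * R) * N))
        ≤⟨ +-mono-≤ main (+-mono-≤ degreeError sizeError) ⟩
      2 * B * (X * V * K) + (2 * B * (N * V) + 2 * B * (s * R * (s * R) * N))
        ≡⟨ solve (B ∷ X ∷ V ∷ K ∷ N ∷ s ∷ R ∷ []) ⟩
      2 * B * (X * V * K + s * R * (s * R) * N + N * V) ∎)
      where
      main : P * (s * s₂ * N) * (4 * B) * K ≤ 2 * B * (X * V * K)
      main = begin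
        P * (s * s₂ * N) * (4 * B) * K                 ≤⟨ *-monoˡ-≤ K (*-monoʳ-≤ (P * (s * s₂ * N)) (*-monoʳ-≤ 4 B≤b⁴)) ⟩
        P * (s * s₂ * N) * (4 * (b * b * b * b)) * K   ≡⟨ cong (λ z → P * (s * s₂ * N) * z * K) (sym V≡) ⟩
        P * (s * s₂ * N) * V * K                       ≡⟨ cong (_* K) (sym base) ⟩
        2 * B * (X * V) * K                            ≡⟨ *-assoc (2 * B) (X * V) K ⟩
        2 * B * (X * V * K) ∎
      degreeError : 2 * B * (s * s₂ * Y * K) * N ≤ 2 * B * (N * V)
      degreeError = begin
        2 * B * (s * s₂ * Y * K) * N ≤⟨ *-monoˡ-≤ N (*-monoʳ-≤ (2 * B) (*-monoˡ-≤ K (*-monoˡ-≤ Y (*-monoʳ-≤ s s₂≤s)))) ⟩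
        2 * B * (s * s * Y * K) * N  ≤⟨ *-monoˡ-≤ N (*-monoʳ-≤ (2 * B) h₂) ⟩
        2 * B * V * N                ≡⟨ solve (B ∷ V ∷ N ∷ []) ⟩
        2 * B * (N * V) ∎
      sizeError : 2 * B * (2 * K * s * (R * R) * N) ≤ 2 * B * (s * R * (s * R) * N)
      sizeError = begin
        2 * B * (2 * K * s * (R * R) * N) ≤⟨ *-monoʳ-≤ (2 * B) (*-monoˡ-≤ N (*-monoˡ-≤ (R * R) (*-monoˡ-≤ s h₁))) ⟩
        2 * B * (s * s * (R * R) * N)     ≡⟨ solve (B ∷ s ∷ R ∷ N ∷ []) ⟩
        2 * B * (s * R * (s * R) * N) ∎

module Estimates where

  open import Data.Nat using (ℕ; zero; suc; _+_; _*_; _∸_; _^_; _≤_; _<_; z≤n; s≤s)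
  open import Data.Nat.Properties
  open import Data.Product using (_×_; _,_; proj₁; proj₂)
  import Data.Rational as Q
  open import Relation.Binary.PropositionalEquality
  open import Data.Nat.Tactic.RingSolver using (solve-∀)
  open RestrictedCount
  open RationalBounds
  open NatBounds

  proportional-estimates : ∀ X N U V W c → 0 < N → 0 < V → X * V ≡ W * suc c → U * N ≡ W * c →
    (1 ≤ c → ratio X N Q.≤ ℕtoℚ 2 Q.* ratio U V) ×
    (∀ k → suc k ≤ c → ∀ ε → ratio 1 (suc k) Q.≤ ε → Q.∣ ratio X N Q.- ratio U V ∣ Q.≤ ε Q.* ratio U V)
  proportional-estimates X N U V W c N>0 V>0 e₁ e₂ = twice , close
    where
    twice : 1 ≤ c → ratio X N Q.≤ ℕtoℚ 2 Q.* ratio U V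
    twice h = bigO-criterion X N U V 2 N>0 V>0 (proj₁ (proportional-bounds X V U N W c 1 e₁ e₂) h)
    close : ∀ k → suc k ≤ c → ∀ ε → ratio 1 (suc k) Q.≤ ε → Q.∣ ratio X N Q.- ratio U V ∣ Q.≤ ε Q.* ratio U V
    close k h =
      let (_ , above , below) = proportional-bounds X V U N W c (suc k) e₁ e₂
      in relative-criterion X N U V k N>0 V>0 (above h) below

  -- Loops: with 2ℓ = R, the mean ℓ·rpm(a,b-2)/rpm(a,b) equals (b-a)R/(2b(b-1)),
  -- in proportion b : b-1 to μ₀ = (b-a)R/2b².
  loop-estimates : ∀ a b ℓ R → 2 * ℓ ≡ R → 2 ≤ b → 0 < rpm a b →
    (ratio (ℓ * rpm a (b ∸ 2)) (rpm a b) Q.≤ ℕtoℚ 2 Q.* ratio ((b ∸ a) * R) (2 * b ^ 2)) ×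
    (∀ k → 2 + k ≤ b → ∀ ε → ratio 1 (suc k) Q.≤ ε →
       Q.∣ ratio (ℓ * rpm a (b ∸ 2)) (rpm a b) Q.- ratio ((b ∸ a) * R) (2 * b ^ 2) ∣ Q.≤ ε Q.* ratio ((b ∸ a) * R) (2 * b ^ 2))
  loop-estimates a (suc (suc c)) ℓ R 2ℓ≡R (s≤s (s≤s z≤n)) N>0 =
    let (twice , close) = proportional-estimates (ℓ * rpm a c) (rpm a b) ((b ∸ a) * R) (2 * b ^ 2) W (suc c)
                            N>0 (s≤s z≤n) crossX crossU
    in twice (s≤s z≤n) , λ { k (s≤s (s≤s k≤c)) → close k (s≤s k≤c) }
    where
    b W : ℕ
    b = suc (suc c)
    W = R * rpm a c * b
    crossX : ℓ * rpm a c * (2 * b ^ 2) ≡ W * b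
    crossX = trans (regroup ℓ (rpm a c) b) (cong (λ z → z * rpm a c * b * b) 2ℓ≡R)
      where
      regroup : ∀ ℓ g b → ℓ * g * (2 * (b * (b * 1))) ≡ 2 * ℓ * g * b * b
      regroup = solve-∀
    crossU : (b ∸ a) * R * rpm a b ≡ W * suc c
    crossU = trans (regroup₁ (b ∸ a) R (rpm a b)) (trans (cong (R *_) (rpm-ratio a c)) (regroup₂ R (rpm a c) c))
      where
      regroup₁ : ∀ s R N → s * R * N ≡ R * (s * N)
      regroup₁ = solve-∀
      regroup₂ : ∀ R g c → R * (suc (suc c) * suc c * g) ≡ R * g * suc (suc c) * suc c
      regroup₂ = solve-∀

  -- Mixed double pairs: with 2X = L₂R·rpm(a-2,b-2), the mean X/rpm(a,b) equals
  -- L₂R/(2b(b-1)) (both vanish when a ≤ 1, as then L₂ = 0), in proportion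
  -- b : b-1 to μ₁ = L₂R/2b².
  mixed-estimates : ∀ a b X L₂ R → 2 * X ≡ L₂ * R * rpm (a ∸ 2) (b ∸ 2) → (a ≤ 1 → L₂ ≡ 0) → 2 ≤ b → 0 < rpm a b →
    (ratio X (rpm a b) Q.≤ ℕtoℚ 2 Q.* ratio (R * L₂) (2 * b ^ 2)) ×
    (∀ k → 2 + k ≤ b → ∀ ε → ratio 1 (suc k) Q.≤ ε →
       Q.∣ ratio X (rpm a b) Q.- ratio (R * L₂) (2 * b ^ 2) ∣ Q.≤ ε Q.* ratio (R * L₂) (2 * b ^ 2))
  mixed-estimates a (suc (suc c)) X L₂ R 2X≡ L₂≡0 (s≤s (s≤s z≤n)) N>0 =
    let (twice , close) = proportional-estimates X (rpm a b) (R * L₂) (2 * b ^ 2) W (suc c)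
                            N>0 (s≤s z≤n) crossX (crossU a 2X≡ L₂≡0)
    in twice (s≤s z≤n) , λ { k (s≤s (s≤s k≤c)) → close k (s≤s k≤c) }
    where
    b W : ℕ
    b = suc (suc c)
    W = 2 * X * b
    crossX : X * (2 * b ^ 2) ≡ W * b
    crossX = regroup X b
      where
      regroup : ∀ X b → X * (2 * (b * (b * 1))) ≡ 2 * X * b * b
      regroup = solve-∀
    -- every L-point is matched into R; with fewer than two L-points, L₂ = 0
    crossU : ∀ a → 2 * X ≡ L₂ * R * rpm (a ∸ 2) c → (a ≤ 1 → L₂ ≡ 0) → R * L₂ * rpm a b ≡ W * suc c
    crossU (suc (suc a'')) e _ = trans (regroup R L₂ (rpm a'' c) c) (cong (λ z → z * b * suc c) (sym e))
      where
      regroup : ∀ R L g c → R * L * (suc (suc c) * (suc c * g)) ≡ L * R * g * suc (suc c) * suc c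
      regroup = solve-∀
    crossU zero e vanish = noLPairs (vanish z≤n) e
      where
      noLPairs : L₂ ≡ 0 → 2 * X ≡ L₂ * R * rpm 0 c → R * L₂ * rpm 0 b ≡ W * suc c
      noLPairs refl e = trans (cong (_* rpm 0 b) (*-zeroʳ R)) (cong (λ z → z * b * suc c) (sym e))
    crossU (suc zero) e vanish = noLPairs (vanish (s≤s z≤n)) e
      where
      noLPairs : L₂ ≡ 0 → 2 * X ≡ L₂ * R * rpm 0 c → R * L₂ * rpm 1 b ≡ W * suc c
      noLPairs refl e = trans (cong (_* rpm 1 b) (*-zeroʳ R)) (cong (λ z → z * b * suc c) (sym e))

  rpm-excess₂ : ∀ a e → (4 + e ∸ a) * ((4 + e ∸ a) ∸ 2) * rpm a (4 + e) ≡ B4 (1 + e) * rpm a e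
  rpm-excess₂ a e = begin
    s * (s ∸ 2) * rpm a (4 + e)                       ≡⟨ swap s (s ∸ 2) (rpm a (4 + e)) ⟩
    (s ∸ 2) * (s * rpm a (4 + e))                     ≡⟨ cong ((s ∸ 2) *_) (rpm-ratio a (2 + e)) ⟩
    (s ∸ 2) * ((4 + e) * (3 + e) * rpm a (2 + e))     ≡⟨ swap₂ (s ∸ 2) e (rpm a (2 + e)) ⟩
    (4 + e) * (3 + e) * ((s ∸ 2) * rpm a (2 + e))     ≡⟨ cong (λ z → (4 + e) * (3 + e) * (z * rpm a (2 + e))) s∸2≡ ⟩
    (4 + e) * (3 + e) * ((2 + e ∸ a) * rpm a (2 + e)) ≡⟨ cong ((4 + e) * (3 + e) *_) (rpm-ratio a e) ⟩
    (4 + e) * (3 + e) * ((2 + e) * (1 + e) * rpm a e) ≡⟨ product e (rpm a e) ⟩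
    B4 (1 + e) * rpm a e ∎
    where
    open ≡-Reasoning
    s : ℕ
    s = 4 + e ∸ a
    s∸2≡ : s ∸ 2 ≡ 2 + e ∸ a
    s∸2≡ = trans (∸-+-assoc (4 + e) a 2) (trans (cong (4 + e ∸_) (+-comm a 2)) (sym (∸-+-assoc (4 + e) 2 a)))
    swap : ∀ s t N → s * t * N ≡ t * (s * N)
    swap = solve-∀
    swap₂ : ∀ t e g → t * ((4 + e) * (3 + e) * g) ≡ (4 + e) * (3 + e) * (t * g)
    swap₂ = solve-∀
    product : ∀ e g → (4 + e) * (3 + e) * ((2 + e) * (1 + e) * g) ≡ (4 + e) * (3 + e) * (2 + e) * (1 + e) * g
    product = solve-∀

  -- Pure double pairs: with 2X = P·rpm(a,b-4) and P = R²/2 up to the degree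
  -- error (dmax² + dmax)R, the mean X/rpm(a,b) is compared with
  -- μ₂ = μ₀² = ((b-a)R/2b²)².
  pure-estimates : ∀ a b X P R dm → 0 < rpm a b → 2 * X ≡ P * rpm a (b ∸ 4) →
    2 * P ≤ R * R → R * R ≤ 2 * P + (dm * dm + dm) * R → R ≤ dm * b → 4 ≤ b →
    (6 ≤ b → ratio X (rpm a b) Q.≤ ℕtoℚ 32 Q.* (ratio ((b ∸ a) * R) (2 * b ^ 2) Q.* ratio ((b ∸ a) * R) (2 * b ^ 2))) ×
    (∀ k → 4 + 255 * suc k ≤ b → 2 * suc k ≤ b ∸ a → dm * dm * dm * suc k ≤ 2 * b →
       ∀ ε → ratio 1 (suc k) Q.≤ ε →
       Q.∣ ratio X (rpm a b) Q.- ratio ((b ∸ a) * R) (2 * b ^ 2) Q.* ratio ((b ∸ a) * R) (2 * b ^ 2) ∣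
         Q.≤ ε Q.* (ratio ((b ∸ a) * R) (2 * b ^ 2) Q.* ratio ((b ∸ a) * R) (2 * b ^ 2)) Q.+ ε)
  pure-estimates a b@(suc (suc (suc (suc e)))) X P R dm N>0 2X≡ P-upper P-lower R≤dm*b (s≤s (s≤s (s≤s (s≤s z≤n)))) =
    bigO , asymp
    where
    s N V : ℕ
    s = b ∸ a
    N = rpm a b
    V = 2 * b ^ 2 * (2 * b ^ 2)
    μ : Q.ℚ
    μ = ratio (s * R) (2 * b ^ 2)
    μ²≡ : μ Q.* μ ≡ ratio (s * R * (s * R)) V
    μ²≡ = ratio-*-pos (s * R) (2 * b ^ 2) (s * R) (2 * b ^ 2) (s≤s z≤n) (s≤s z≤n)
    V≡ : V ≡ 4 * (b * b * b * b)
    V≡ = fourth b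
      where
      fourth : ∀ x → 2 * (x * (x * 1)) * (2 * (x * (x * 1))) ≡ 4 * (x * x * x * x)
      fourth = solve-∀
    open PureArithmetic X N P (rpm a e) s (s ∸ 2) R (B4 (suc e)) b ((dm * dm + dm) * R) V
           2X≡ (rpm-excess₂ a e) P-upper P-lower (s²≤s[s-2]+2s s) (m∸n≤m s 2) (B4≤b⁴ (suc e)) V≡
    bigO : 6 ≤ b → ratio X N Q.≤ ℕtoℚ 32 Q.* (μ Q.* μ)
    bigO (s≤s (s≤s (s≤s (s≤s 2≤e)))) =
      subst (λ z → ratio X N Q.≤ ℕtoℚ 32 Q.* z) (sym μ²≡)
        (bigO-criterion X N (s * R * (s * R)) V 32 N>0 (s≤s z≤n) (pure-bigO (b⁴≤16B4 (suc e) (s≤s 2≤e))))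
    asymp : ∀ k → 4 + 255 * suc k ≤ b → 2 * suc k ≤ s → dm * dm * dm * suc k ≤ 2 * b →
      ∀ ε → ratio 1 (suc k) Q.≤ ε → Q.∣ ratio X N Q.- μ Q.* μ ∣ Q.≤ ε Q.* (μ Q.* μ) Q.+ ε
    asymp k (s≤s (s≤s (s≤s (s≤s big)))) 2K≤s dm³K≤2b ε hε =
      subst (λ z → Q.∣ ratio X N Q.- z ∣ Q.≤ ε Q.* z Q.+ ε) (sym μ²≡)
        (relativePlusAbsolute-criterion X N (s * R * (s * R)) V k N>0 (s≤s z≤n)
          (pure-above (suc k) (b⁴≈B4 (suc e) (suc k) (grow big)))
          (pure-below (suc k) 2K≤s (≤-trans (smallDegree-bound s b R dm (suc k) (m∸n≤m b a) R≤dm*b dm³K≤2b) (≤-reflexive (sym V≡))))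
          ε hε)
      where
      grow : 255 * suc k ≤ e → 255 * suc k + 1 ≤ suc e
      grow h = ≤-trans (≤-reflexive (+-comm (255 * suc k) 1)) (s≤s h)


open import Data.Nat using (ℕ; suc; _+_; _*_; _∸_; _^_; _≤_; _<_; _⊔_)
open import Data.Nat.Properties
open import Data.Nat.ListAction using (sum)
open import Data.Product using (_×_; _,_; proj₁; proj₂; ∃)
open import Data.List using (map)
open import Data.Fin using (Fin)
open import Data.Bool using (Bool)
import Data.Rational as Q
open import Relation.Binary.PropositionalEquality
open import Data.Nat.Tactic.RingSolver using (solve-∀)
open RestrictedCount
open RationalBounds
open PairingModel
open Estimates

eventually-× : ∀ {P Q : ℕ → Set} → Eventually P → Eventually Q → Eventually (λ n → P n × Q n)
eventually-× (N₁ , h₁) (N₂ , h₂) =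
  N₁ ⊔ N₂ , λ n h → h₁ n (≤-trans (m≤m⊔n N₁ N₂) h) , h₂ n (≤-trans (m≤n⊔m N₁ N₂) h)

eventually-mono : ∀ {P Q : ℕ → Set} → (∀ n → P n → Q n) → Eventually P → Eventually Q
eventually-mono f (N , h) = N , λ n le → f n (h n le)

module SingleInstance {n : ℕ} (inL : Fin n → Bool) (d : Fin n → ℕ)
  (even : ∃ λ k → M inL d ≡ 2 * k) (balanced : M₁L inL d ≤ M₁R inL d) where

  open Instance inL d

  a b : ℕ
  a = M₁L inL d
  b = M₁R inL d

  M≤2b : M inL d ≤ 2 * b
  M≤2b = ≤-trans (≤-reflexive M-split) (≤-trans (+-monoˡ-≤ b balanced) (≤-reflexive (double b)))
    where
    double : ∀ b → b + b ≡ 2 * b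
    double = solve-∀

  -- b - a = M - 2a is even, so restricted pairings exist.
  pairings-exist : 0 < rpm a b
  pairings-exist = subst (λ z → 0 < rpm a z) (sym b≡) (rpm-pos a (k ∸ a))
    where
    k t : ℕ
    k = proj₁ even
    t = b ∸ a
    split : ∀ a t → a + (a + t) ≡ 2 * a + t
    split = solve-∀
    2a+t≡2k : 2 * a + t ≡ 2 * k
    2a+t≡2k = trans (sym (split a t)) (trans (cong (a +_) (m+[n∸m]≡n balanced)) (trans (sym M-split) (proj₂ even)))
    t≡ : t ≡ 2 * (k ∸ a)
    t≡ = trans (sym (m+n∸m≡n (2 * a) t)) (trans (cong (_∸ (2 * a)) 2a+t≡2k) (sym (*-distribˡ-∸ 2 k a)))
    b≡ : b ≡ a + 2 * (k ∸ a)
    b≡ = trans (sym (m+[n∸m]≡n balanced)) (cong (a +_) t≡)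

  𝔼-exact : ∀ X → 𝔼 inL d X ≡ ratio (sum (map X RP)) (rpm a b)
  𝔼-exact X = cong (ratio (sum (map X RP))) #restricted

  E₀≡ : 𝔼 inL d (B₀ inL) ≡ ratio (loopWeight * rpm a (b ∸ 2)) (rpm a b)
  E₀≡ = trans (𝔼-exact (B₀ inL)) (cong (λ z → ratio z (rpm a b)) sumB₀)


  loops-bound : 2 ≤ b → 𝔼 inL d (B₀ inL) Q.≤ ℕtoℚ 2 Q.* μ₀ inL d
  loops-bound 2≤b = subst (Q._≤ ℕtoℚ 2 Q.* μ₀ inL d) (sym E₀≡)
    (proj₁ (loop-estimates a b loopWeight (M₂R inL d) loopWeight-M₂R 2≤b pairings-exist))

  loops-close : ∀ k → 2 + k ≤ b → ∀ ε → ratio 1 (suc k) Q.≤ ε → Q.∣ 𝔼 inL d (B₀ inL) Q.- μ₀ inL d ∣ Q.≤ ε Q.* μ₀ inL d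
  loops-close k h ε hε = subst (λ E → Q.∣ E Q.- μ₀ inL d ∣ Q.≤ ε Q.* μ₀ inL d) (sym E₀≡)
    (proj₂ (loop-estimates a b loopWeight (M₂R inL d) loopWeight-M₂R (≤-trans (m≤m+n 2 k) h) pairings-exist) k h ε hε)

  mixed-bound : 2 ≤ b → 𝔼 inL d (B₁ inL) Q.≤ ℕtoℚ 2 Q.* μ₁ inL d
  mixed-bound 2≤b = subst (Q._≤ ℕtoℚ 2 Q.* μ₁ inL d) (sym (𝔼-exact (B₁ inL)))
    (proj₁ (mixed-estimates a b (sum (map (B₁ inL) RP)) (M₂L inL d) (M₂R inL d) sumB₁ M₂L-vanishes 2≤b pairings-exist))

  mixed-close : ∀ k → 2 + k ≤ b → ∀ ε → ratio 1 (suc k) Q.≤ ε → Q.∣ 𝔼 inL d (B₁ inL) Q.- μ₁ inL d ∣ Q.≤ ε Q.* μ₁ inL d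
  mixed-close k h ε hε = subst (λ E → Q.∣ E Q.- μ₁ inL d ∣ Q.≤ ε Q.* μ₁ inL d) (sym (𝔼-exact (B₁ inL)))
    (proj₂ (mixed-estimates a b (sum (map (B₁ inL) RP)) (M₂L inL d) (M₂R inL d) sumB₁ M₂L-vanishes
                                (≤-trans (m≤m+n 2 k) h) pairings-exist) k h ε hε)

  pure-bound : 6 ≤ b → 𝔼 inL d (B₂ inL) Q.≤ ℕtoℚ 32 Q.* μ₂ inL d
  pure-bound 6≤b = subst (Q._≤ ℕtoℚ 32 Q.* μ₂ inL d) (sym (𝔼-exact (B₂ inL)))
    (proj₁ (pure-estimates a b (sum (map (B₂ inL) RP)) pureWeight (M₂R inL d) (dmax inL d) pairings-exist sumB₂
              pureWeight-upper pureWeight-lower M₂R≤dmax*M₁R (≤-trans (m≤m+n 4 2) 6≤b)) 6≤b)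

  pure-close : ∀ k → 4 + 255 * suc k ≤ b → 2 * suc k ≤ b ∸ a → dmax inL d * dmax inL d * dmax inL d * suc k ≤ M inL d →
    ∀ ε → ratio 1 (suc k) Q.≤ ε → Q.∣ 𝔼 inL d (B₂ inL) Q.- μ₂ inL d ∣ Q.≤ ε Q.* μ₂ inL d Q.+ ε
  pure-close k big excess small ε hε = subst (λ E → Q.∣ E Q.- μ₂ inL d ∣ Q.≤ ε Q.* μ₂ inL d Q.+ ε) (sym (𝔼-exact (B₂ inL)))
    (proj₂ (pure-estimates a b (sum (map (B₂ inL) RP)) pureWeight (M₂R inL d) (dmax inL d) pairings-exist sumB₂
              pureWeight-upper pureWeight-lower M₂R≤dmax*M₁R (≤-trans (m≤m+n 4 (255 * suc k)) big))
       k big excess (≤-trans small M≤2b) ε hε)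

-- dmax = o(M^{1/3}) is used in the form dmax³(k+1) ≤ M.
cube-below : ∀ x M k → ℕtoℚ (x ^ 3) Q.≤ ratio 1 (suc k) Q.* ℕtoℚ M → x * x * x * suc k ≤ M
cube-below x M k h = ≤-trans (≤-reflexive (cong (_* suc k) (cubed x))) (below-unitFraction (x ^ 3) M k h)
  where
  cubed : ∀ x → x * x * x ≡ x * (x * (x * 1))
  cubed = solve-∀

-- Along a family satisfying the standing assumptions, b = M₁(R) → ∞ since
-- M ≤ 2b, so the estimates of each single instance eventually apply.
module Along (F : Family) (standing : Standing F) where

  module At (m : ℕ) = SingleInstance (proj₁ (F m)) (proj₂ (F m)) (proj₁ standing m) (proj₁ (proj₂ standing) m)

  b-large : ∀ T → Eventually (λ m → T ≤ At.b m)
  b-large T = eventually-mono (λ m h → *-cancelˡ-≤ 2 (≤-trans h (At.M≤2b m))) (proj₂ (proj₂ standing) (2 * T))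

  EB₀-bigO : BigO (EB₀ F) (μ₀F F)
  EB₀-bigO = 2 , eventually-mono At.loops-bound (b-large 2)

  EB₁-bigO : BigO (EB₁ F) (μ₁F F)
  EB₁-bigO = 2 , eventually-mono At.mixed-bound (b-large 2)

  EB₂-bigO : BigO (EB₂ F) (μ₂F F)
  EB₂-bigO = 32 , eventually-mono At.pure-bound (b-large 6)

  EB₀-asymp : Asymp (EB₀ F) (μ₀F F)
  EB₀-asymp ε ε>0 with unitFraction-below ε ε>0
  ... | k , 1/k≤ε = eventually-mono (λ m h → At.loops-close m k h ε 1/k≤ε) (b-large (2 + k))

  EB₁-asymp : Asymp (EB₁ F) (μ₁F F)
  EB₁-asymp ε ε>0 with unitFraction-below ε ε>0
  ... | k , 1/k≤ε = eventually-mono (λ m h → At.mixed-close m k h ε 1/k≤ε) (b-large (2 + k))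

  EB₂-asymp : ExtraHyp F → AsympPlusSmall (EB₂ F) (μ₂F F)
  EB₂-asymp (dmax-small , excess-large) ε ε>0 with unitFraction-below ε ε>0
  ... | k , 1/k≤ε = eventually-mono
    (λ { m ((big , excess) , small) →
         At.pure-close m k big excess (cube-below (dmax (proj₁ (F m)) (proj₂ (F m))) _ k small) ε 1/k≤ε })
    (eventually-× (eventually-× (b-large (4 + 255 * suc k)) (excess-large (2 * suc k)))
                  (dmax-small (ratio 1 (suc k)) (unitFraction-pos k)))

lemma3p3 : (F : Family) → Standing F →
    (BigO (EB₀ F) (μ₀F F) × BigO (EB₁ F) (μ₁F F) × BigO (EB₂ F) (μ₂F F))
    × (ExtraHyp F →
        Asymp (EB₀ F) (μ₀F F) × Asymp (EB₁ F) (μ₁F F) × AsympPlusSmall (EB₂ F) (μ₂F F))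
lemma3p3 F standing =
  (EB₀-bigO , EB₁-bigO , EB₂-bigO) , λ extra → EB₀-asymp , EB₁-asymp , EB₂-asymp extra
  where
  open Along F standing
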